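{- Let $G$ be a computable group with an action on $\mathbf{CE}$ that is computable in indices. For $\gamma\in G$ define $F_\gamma:\omega\to\omega$ by $F_\gamma(n)=m\iff\gamma\cdot\{n\}=\{m\}$. Then for every $\gamma\in G$, $F_\gamma$ is a (well-defined) computable permutation of $\omega$, and $\gamma\cdot V=\{F_\gamma(n):n\in V\}$ for every c.e.\ set $V$.
   Context: $(W_e)_{e\in\omega}$ is a standard uniform enumeration of the c.e.\ subsets of $\omega$ and $\mathbf{CE}$ is the collection of c.e.\ subsets of $\omega$. An action of a computable group $G$ on $\mathbf{CE}$ (acting on the sets themselves) is computable in indices if there is a computable $\alpha:G\times\omega\to\omega$ such that $W_{\alpha(\gamma,e)}=\gamma\cdot W_e$ for all $\gamma\in G$ and $e\in\omega$. -}

module Defs where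

open import Data.Nat using (ℕ; zero; suc; _+_; _≡ᵇ_)
open import Data.Bool using (Bool; true; false)
open import Data.Product using (Σ; ∃; _×_; _,_; proj₁; proj₂)
open import Data.Maybe using (Maybe; just; nothing; _>>=_)
open import Relation.Binary.PropositionalEquality using (_≡_)
open import Relation.Unary using (Pred; _≐_)
open import Level using (0ℓ)

tri : ℕ → ℕ
tri zero    = zero
tri (suc d) = suc d + tri d

pair : ℕ → ℕ → ℕ
pair a b = tri (a + b) + b

-- inverse of pair, enumerating the diagonals (0,0),(1,0),(0,1),(2,0),…
unpair : ℕ → ℕ × ℕ
unpair zero    = 0 , 0
unpair (suc n) with unpair n
... | zero  , b = suc b , 0
... | suc a , b = a , suc b

fst snd : ℕ → ℕ
fst n = proj₁ (unpair n)
snd n = proj₂ (unpair n)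

data Code : Set where
  Z   : Code
  S   : Code
  I   : Code
  L   : Code
  R   : Code
  C   : Code → Code → Code
  P   : Code → Code → Code
  Rec : Code → Code → Code   -- Rec f g : ⟨x,0⟩ ↦ f x ;
                             --   ⟨x,n+1⟩ ↦ g ⟨x,⟨n, h⟨x,n⟩⟩⟩
  Mu  : Code → Code          -- Mu f : x ↦ least n with f⟨x,n⟩ = 0
                             --   (all f⟨x,i⟩, i < n, defined)

-- Gödel numbering (surjective): e = ⟨tag , rest⟩; fuel e suffices
decodeF : ℕ → ℕ → Code
decodeF zero    _ = Z
decodeF (suc k) n with unpair n
... | 0 , _ = Z
... | 1 , _ = S
... | 2 , _ = I
... | 3 , _ = L
... | 4 , _ = R
... | 5 , r = C   (decodeF k (fst r)) (decodeF k (snd r))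
... | 6 , r = P   (decodeF k (fst r)) (decodeF k (snd r))
... | 7 , r = Rec (decodeF k (fst r)) (decodeF k (snd r))
... | 8 , r = Mu  (decodeF k r)
... | _ , _ = Z

decode : ℕ → Code
decode e = decodeF e e

recIter : (ℕ → Maybe ℕ) → (ℕ → Maybe ℕ) → ℕ → ℕ → Maybe ℕ
recIter f g x zero    = f x
recIter f g x (suc n) = recIter f g x n >>= λ h → g (pair x (pair n h))

muSearch : (ℕ → Maybe ℕ) → ℕ → ℕ → Maybe ℕ
muSearch h zero    i = nothing
muSearch h (suc b) i with h i
... | nothing    = nothing
... | just zero  = just i
... | just (suc _) = muSearch h b (suc i)

eval : ℕ → Code → ℕ → Maybe ℕ
eval zero    _         _ = nothing
eval (suc k) Z         x = just 0
eval (suc k) S         x = just (suc x)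
eval (suc k) I         x = just x
eval (suc k) L         x = just (fst x)
eval (suc k) R         x = just (snd x)
eval (suc k) (C f g)   x = eval k g x >>= eval k f
eval (suc k) (P f g)   x = eval k f x >>= λ a → eval k g x >>= λ b → just (pair a b)
eval (suc k) (Rec f g) x = recIter (eval k f) (eval k g) (fst x) (snd x)
eval (suc k) (Mu f)    x = muSearch (λ i → eval k f (pair x i)) (suc k) 0

_⟨_⟩↓=_ : ℕ → ℕ → ℕ → Set
e ⟨ x ⟩↓= y = ∃ λ k → eval k (decode e) x ≡ just y

W : ℕ → Pred ℕ 0ℓ
W e x = ∃ λ y → e ⟨ x ⟩↓= y

IsCE : Pred ℕ 0ℓ → Set
IsCE V = ∃ λ e → V ≐ W e

-- the collection CE of c.e. subsets of ω (sets compared extensionally by ≐)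
CE : Set₁
CE = Σ (Pred ℕ 0ℓ) IsCE

set : CE → Pred ℕ 0ℓ
set = proj₁

W̃ : ℕ → CE
W̃ e = W e , e , ((λ p → p) , (λ p → p))

singleton : ℕ → Pred ℕ 0ℓ
singleton n m = m ≡ n

image : (ℕ → ℕ) → Pred ℕ 0ℓ → Pred ℕ 0ℓ
image F V m = ∃ λ n → V n × F n ≡ m

Computable : (ℕ → ℕ) → Set
Computable f = ∃ λ e → ∀ n → e ⟨ n ⟩↓= f n

Computable₂ : (ℕ → ℕ → ℕ) → Set
Computable₂ f = Computable (λ p → f (fst p) (snd p))

χ : (ℕ → Bool) → ℕ → ℕ
χ d n with d n
... | true  = 1
... | false = 0

-- computable groups: domain a computable subset of ω, identity of
-- elements is equality of numbers, operations computable

record ComputableGroup : Set where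
  field
    dom   : ℕ → Bool
    _∙_   : ℕ → ℕ → ℕ
    ε     : ℕ
    _⁻¹   : ℕ → ℕ
  InG : ℕ → Set
  InG n = dom n ≡ true
  field
    dom-computable : Computable (χ dom)
    ∙-computable   : Computable₂ _∙_
    ⁻¹-computable  : Computable _⁻¹
    ∙-closed  : ∀ {a b} → InG a → InG b → InG (a ∙ b)
    ε-in      : InG ε
    ⁻¹-closed : ∀ {a} → InG a → InG (a ⁻¹)
    assoc     : ∀ {a b c} → InG a → InG b → InG c → (a ∙ b) ∙ c ≡ a ∙ (b ∙ c)
    identityˡ : ∀ {a} → InG a → ε ∙ a ≡ a
    identityʳ : ∀ {a} → InG a → a ∙ ε ≡ a
    inverseˡ  : ∀ {a} → InG a → (a ⁻¹) ∙ a ≡ ε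
    inverseʳ  : ∀ {a} → InG a → a ∙ (a ⁻¹) ≡ ε

-- actions of G on CE (acting on the sets themselves; sets are equal
-- when they have the same elements)

record Action (G : ComputableGroup) : Set₁ where
  open ComputableGroup G
  field
    act      : ℕ → CE → CE
    act-cong : ∀ {γ} → InG γ → ∀ U V → set U ≐ set V → set (act γ U) ≐ set (act γ V)
    act-ε    : ∀ V → set (act ε V) ≐ set V
    act-∙    : ∀ {γ δ} → InG γ → InG δ → ∀ V →
               set (act (γ ∙ δ) V) ≐ set (act γ (act δ V))

-- computable in indices: a computable α : G × ω → ω with
-- W_{α(γ,e)} = γ · W_e (α is taken total on ω × ω; since the domain of
-- G is computable this is no loss)
ComputableInIndices : (G : ComputableGroup) → Action G → Set
ComputableInIndices G A =
  ∃ λ (α : ℕ → ℕ → ℕ) → Computable₂ α ×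
    (∀ γ → ComputableGroup.InG G γ → ∀ e → W (α γ e) ≐ set (Action.act A γ (W̃ e)))

{-# OPTIONS --safe #-}
-- An action computable in indices is monotone: if U ⊆ V and m ∈ γ·U ∖ γ·V, the uniformly c.e.
-- sets W_{f x} = U ∪ (V if x ∈ K) would make ω ∖ K = {x : m ∈ γ·W_{f x}} c.e.; excluded middle turns
-- the resulting ¬¬(m ∈ γ·V) into m ∈ γ·V. Monotonicity together with γ⁻¹·(γ·V) = V forces γ·{n} to
-- be a singleton {F n}, makes F_{γ⁻¹} inverse to F_γ and gives γ·V = ⋃_{n∈V} γ·{n}. Finally F_γ n is
-- found by dovetailing the enumeration of W_{α(γ, s n)}, s n an index of {n} computed by s-m-n;
-- this needs the universal function, realised by a stack machine whose transition function is
-- primitive recursive.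
module Submission where

open import Defs
open import Data.Nat using (ℕ; zero; suc; pred; _+_; _∸_; _≤_; _<_; _⊔_; z≤n; s≤s; _<?_)
open import Data.Fin using (Fin; zero; suc)
import Data.Fin as Fin
open import Data.Vec using (Vec; []; _∷_; lookup)
open import Data.List using (List; []; _∷_)
open import Relation.Nullary.Decidable using (True)
open import Relation.Binary.Construct.Closure.ReflexiveTransitive using (Star; _◅_; _◅◅_) renaming (ε to done)
open import Induction.WellFounded using (Acc; acc)
open import Data.Nat.Induction using (<-wellFounded)
open import Data.Empty using (⊥-elim)
open import Relation.Nullary using (¬_)
open import Data.Nat.Properties
open import Data.Nat.GeneralisedArithmetic using (fold; iterate; iterate-is-fold)
open import Data.Product using (Σ; ∃; ∃₂; _×_; _,_; proj₁; proj₂)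
open import Data.Maybe using (Maybe; just; _>>=_)
open import Relation.Binary.PropositionalEquality
open import Relation.Unary using (_≐_; _⊆_)
open import Relation.Unary.Properties using (≐-trans; ≐-sym)
open import Function.Definitions using (Bijective)
open import Function.Bundles using (_⇔_; mk⇔; Equivalence)
open import Function.Properties.Equivalence using () renaming (trans to ⇔-trans)
open import Data.Sum using (_⊎_; inj₁; inj₂; [_,_]′)
open import Axiom.ExcludedMiddle using (ExcludedMiddle)
open import Axiom.DoubleNegationElimination using (em⇒dne)
open import Level using (0ℓ)

pair-suc-snd : ∀ a b → pair a (suc b) ≡ suc (pair (suc a) b)
pair-suc-snd a b = begin
  tri (a + suc b) + suc b   ≡⟨ cong (λ d → tri d + suc b) (+-suc a b) ⟩
  tri (suc a + b) + suc b   ≡⟨ +-suc _ b ⟩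
  suc (tri (suc a + b) + b) ∎
  where open ≡-Reasoning

pair-suc-zero : ∀ a → pair (suc a) 0 ≡ suc (pair 0 a)
pair-suc-zero a = begin
  tri (suc a + 0) + 0 ≡⟨ +-identityʳ _ ⟩
  tri (suc a + 0)     ≡⟨ cong tri (+-identityʳ (suc a)) ⟩
  suc (a + tri a)     ≡⟨ cong suc (+-comm a (tri a)) ⟩
  suc (tri a + a)     ∎
  where open ≡-Reasoning

unpair-suc-zero : ∀ n {b} → unpair n ≡ (0 , b) → unpair (suc n) ≡ (suc b , 0)
unpair-suc-zero n eq rewrite eq = refl

unpair-suc-suc : ∀ n {a b} → unpair n ≡ (suc a , b) → unpair (suc n) ≡ (a , suc b)
unpair-suc-suc n eq rewrite eq = refl

OnDiagonal : ℕ → Set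
OnDiagonal d = unpair (pair d 0) ≡ (d , 0)

-- unpair walks down the diagonal a + b = d from (d , 0) to (0 , d).
unpair-pair-walk : ∀ b a → OnDiagonal (b + a) → unpair (pair a b) ≡ (a , b)
unpair-pair-walk zero    a h = h
unpair-pair-walk (suc b) a h = trans (cong unpair (pair-suc-snd a b))
  (unpair-suc-suc (pair (suc a) b) (unpair-pair-walk b (suc a) (subst OnDiagonal (sym (+-suc b a)) h)))

onDiagonal : ∀ d → OnDiagonal d
onDiagonal zero    = refl
onDiagonal (suc d) = trans (cong unpair (pair-suc-zero d))
  (unpair-suc-zero (pair 0 d) (unpair-pair-walk d 0 (subst OnDiagonal (sym (+-identityʳ d)) (onDiagonal d))))

unpair-pair : ∀ a b → unpair (pair a b) ≡ (a , b)
unpair-pair a b = unpair-pair-walk b a (onDiagonal (b + a))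

fst-pair : ∀ a b → fst (pair a b) ≡ a
fst-pair a b = cong proj₁ (unpair-pair a b)

snd-pair : ∀ a b → snd (pair a b) ≡ b
snd-pair a b = cong proj₂ (unpair-pair a b)

unpair-bound : ∀ n → fst n + snd n ≤ n
unpair-bound zero = z≤n
unpair-bound (suc n) with unpair n | unpair-bound n
... | zero  , b | h = s≤s (subst (_≤ n) (sym (+-identityʳ b)) h)
... | suc a , b | h = subst (_≤ suc n) (sym (+-suc a b)) (m≤n⇒m≤1+n h)

fst≤ : ∀ n → fst n ≤ n
fst≤ n = ≤-trans (m≤m+n _ _) (unpair-bound n)

snd≤ : ∀ n → snd n ≤ n
snd≤ n = ≤-trans (m≤n+m _ _) (unpair-bound n)

snd<-of-positive-fst : ∀ {n t r} → unpair n ≡ (suc t , r) → r < n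
snd<-of-positive-fst {n} eq =
  ≤-trans (s≤s (m≤n+m _ _)) (subst (λ p → proj₁ p + proj₂ p ≤ n) eq (unpair-bound n))

-- decode read structurally; the tags 0 and 9, 10, … all decode to Z.
infix 4 _Encodes_

data _Encodes_ (n : ℕ) : Code → Set where
  #Z    : ∀ {r} → unpair n ≡ (0 , r) → n Encodes Z
  #S    : ∀ {r} → unpair n ≡ (1 , r) → n Encodes S
  #I    : ∀ {r} → unpair n ≡ (2 , r) → n Encodes I
  #L    : ∀ {r} → unpair n ≡ (3 , r) → n Encodes L
  #R    : ∀ {r} → unpair n ≡ (4 , r) → n Encodes R
  #C    : ∀ {r f g} → unpair n ≡ (5 , r) → fst r Encodes f → snd r Encodes g → n Encodes C f g
  #P    : ∀ {r f g} → unpair n ≡ (6 , r) → fst r Encodes f → snd r Encodes g → n Encodes P f g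
  #Rec  : ∀ {r f g} → unpair n ≡ (7 , r) → fst r Encodes f → snd r Encodes g → n Encodes Rec f g
  #Mu   : ∀ {r f} → unpair n ≡ (8 , r) → r Encodes f → n Encodes Mu f
  #junk : ∀ {t r} → unpair n ≡ (9 + t , r) → n Encodes Z

subcode≤ : ∀ {n t r k j} → unpair n ≡ (suc t , r) → n ≤ suc k → j ≤ r → j ≤ k
subcode≤ eq n≤1+k j≤r = ≤-pred (≤-trans (s≤s j≤r) (≤-trans (snd<-of-positive-fst eq) n≤1+k))

decodeF-encodes : ∀ {k n} → n ≤ k → n Encodes decodeF k n
decodeF-encodes {zero} z≤n = #Z refl
decodeF-encodes {suc k} {n} n≤ with unpair n in eq
... | 0 , _ = #Z eq
... | 1 , _ = #S eq
... | 2 , _ = #I eq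
... | 3 , _ = #L eq
... | 4 , _ = #R eq
... | 5 , r = #C eq (decodeF-encodes (subcode≤ eq n≤ (fst≤ r))) (decodeF-encodes (subcode≤ eq n≤ (snd≤ r)))
... | 6 , r = #P eq (decodeF-encodes (subcode≤ eq n≤ (fst≤ r))) (decodeF-encodes (subcode≤ eq n≤ (snd≤ r)))
... | 7 , r = #Rec eq (decodeF-encodes (subcode≤ eq n≤ (fst≤ r))) (decodeF-encodes (subcode≤ eq n≤ (snd≤ r)))
... | 8 , r = #Mu eq (decodeF-encodes (subcode≤ eq n≤ ≤-refl))
... | suc (suc (suc (suc (suc (suc (suc (suc (suc _)))))))) , _ = #junk eq

decode-encodes : ∀ n → n Encodes decode n
decode-encodes n = decodeF-encodes ≤-refl

decodeF-unique : ∀ {k n c} → n Encodes c → n ≤ k → decodeF k n ≡ c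
decodeF-unique {zero} (#Z _)        z≤n = refl
decodeF-unique {zero} (#junk _)     z≤n = refl
decodeF-unique {zero} (#S ())       z≤n
decodeF-unique {zero} (#I ())       z≤n
decodeF-unique {zero} (#L ())       z≤n
decodeF-unique {zero} (#R ())       z≤n
decodeF-unique {zero} (#C () _ _)   z≤n
decodeF-unique {zero} (#P () _ _)   z≤n
decodeF-unique {zero} (#Rec () _ _) z≤n
decodeF-unique {zero} (#Mu () _)    z≤n
decodeF-unique {suc k} (#Z eq)    _ rewrite eq = refl
decodeF-unique {suc k} (#S eq)    _ rewrite eq = refl
decodeF-unique {suc k} (#I eq)    _ rewrite eq = refl
decodeF-unique {suc k} (#L eq)    _ rewrite eq = refl
decodeF-unique {suc k} (#R eq)    _ rewrite eq = refl
decodeF-unique {suc k} (#C eq f g) n≤ rewrite eq =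
  cong₂ C (decodeF-unique f (subcode≤ eq n≤ (fst≤ _))) (decodeF-unique g (subcode≤ eq n≤ (snd≤ _)))
decodeF-unique {suc k} (#P eq f g) n≤ rewrite eq =
  cong₂ P (decodeF-unique f (subcode≤ eq n≤ (fst≤ _))) (decodeF-unique g (subcode≤ eq n≤ (snd≤ _)))
decodeF-unique {suc k} (#Rec eq f g) n≤ rewrite eq =
  cong₂ Rec (decodeF-unique f (subcode≤ eq n≤ (fst≤ _))) (decodeF-unique g (subcode≤ eq n≤ (snd≤ _)))
decodeF-unique {suc k} (#Mu eq f) n≤ rewrite eq = cong Mu (decodeF-unique f (subcode≤ eq n≤ ≤-refl))
decodeF-unique {suc k} (#junk eq) _ rewrite eq = refl

decode-unique : ∀ {n c} → n Encodes c → decode n ≡ c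
decode-unique e = decodeF-unique e ≤-refl

encodes-fst : ∀ {a c} b → a Encodes c → fst (pair a b) Encodes c
encodes-fst {a} b = subst (_Encodes _) (sym (fst-pair a b))

encodes-snd : ∀ a {b c} → b Encodes c → snd (pair a b) Encodes c
encodes-snd a {b} = subst (_Encodes _) (sym (snd-pair a b))

-- Opaque: numbers of concrete programs are astronomically large and must never be normalised.
opaque
  enc : Code → ℕ
  enc Z         = pair 0 0
  enc S         = pair 1 0
  enc I         = pair 2 0
  enc L         = pair 3 0
  enc R         = pair 4 0
  enc (C f g)   = pair 5 (pair (enc f) (enc g))
  enc (P f g)   = pair 6 (pair (enc f) (enc g))
  enc (Rec f g) = pair 7 (pair (enc f) (enc g))
  enc (Mu f)    = pair 8 (enc f)

  enc-encodes : ∀ c → enc c Encodes c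
  enc-encodes Z         = #Z refl
  enc-encodes S         = #S (unpair-pair 1 0)
  enc-encodes I         = #I (unpair-pair 2 0)
  enc-encodes L         = #L (unpair-pair 3 0)
  enc-encodes R         = #R (unpair-pair 4 0)
  enc-encodes (C f g)   =
    #C (unpair-pair 5 (pair (enc f) (enc g))) (encodes-fst (enc g) (enc-encodes f)) (encodes-snd (enc f) (enc-encodes g))
  enc-encodes (P f g)   =
    #P (unpair-pair 6 (pair (enc f) (enc g))) (encodes-fst (enc g) (enc-encodes f)) (encodes-snd (enc f) (enc-encodes g))
  enc-encodes (Rec f g) =
    #Rec (unpair-pair 7 (pair (enc f) (enc g))) (encodes-fst (enc g) (enc-encodes f)) (encodes-snd (enc f) (enc-encodes g))
  enc-encodes (Mu f)    = #Mu (unpair-pair 8 (enc f)) (enc-encodes f)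

decode-enc : ∀ c → decode (enc c) ≡ c
decode-enc c = decode-unique (enc-encodes c)

infix 4 _⊢_⇓_

data _⊢_⇓_ : Code → ℕ → ℕ → Set
data RecRun (f g : Code) (x : ℕ) : ℕ → ℕ → Set
data MuRun (f : Code) (x : ℕ) : ℕ → ℕ → Set

data _⊢_⇓_ where
  ⇓Z   : ∀ {x} → Z ⊢ x ⇓ 0
  ⇓S   : ∀ {x} → S ⊢ x ⇓ suc x
  ⇓I   : ∀ {x} → I ⊢ x ⇓ x
  ⇓L   : ∀ {x} → L ⊢ x ⇓ fst x
  ⇓R   : ∀ {x} → R ⊢ x ⇓ snd x
  ⇓C   : ∀ {f g x z y} → g ⊢ x ⇓ z → f ⊢ z ⇓ y → C f g ⊢ x ⇓ y
  ⇓P   : ∀ {f g x a b} → f ⊢ x ⇓ a → g ⊢ x ⇓ b → P f g ⊢ x ⇓ pair a b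
  ⇓Rec : ∀ {f g x y} → RecRun f g (fst x) (snd x) y → Rec f g ⊢ x ⇓ y
  ⇓Mu  : ∀ {f x y} → MuRun f x 0 y → Mu f ⊢ x ⇓ y

data RecRun f g x where
  rec-zero : ∀ {y} → f ⊢ x ⇓ y → RecRun f g x 0 y
  rec-suc  : ∀ {n h y} → RecRun f g x n h → g ⊢ pair x (pair n h) ⇓ y → RecRun f g x (suc n) y

data MuRun f x where
  mu-found : ∀ {i} → f ⊢ pair x i ⇓ 0 → MuRun f x i i
  mu-next  : ∀ {i v y} → f ⊢ pair x i ⇓ suc v → MuRun f x (suc i) y → MuRun f x i y

⇓-deterministic : ∀ {c x y y′} → c ⊢ x ⇓ y → c ⊢ x ⇓ y′ → y ≡ y′
rec-deterministic : ∀ {f g x n y y′} → RecRun f g x n y → RecRun f g x n y′ → y ≡ y′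
mu-deterministic : ∀ {f x i y y′} → MuRun f x i y → MuRun f x i y′ → y ≡ y′
⇓-deterministic ⇓Z ⇓Z = refl
⇓-deterministic ⇓S ⇓S = refl
⇓-deterministic ⇓I ⇓I = refl
⇓-deterministic ⇓L ⇓L = refl
⇓-deterministic ⇓R ⇓R = refl
⇓-deterministic (⇓C d₁ d₂) (⇓C e₁ e₂) with refl ← ⇓-deterministic d₁ e₁ = ⇓-deterministic d₂ e₂
⇓-deterministic (⇓P d₁ d₂) (⇓P e₁ e₂) = cong₂ pair (⇓-deterministic d₁ e₁) (⇓-deterministic d₂ e₂)
⇓-deterministic (⇓Rec d) (⇓Rec e) = rec-deterministic d e
⇓-deterministic (⇓Mu d) (⇓Mu e) = mu-deterministic d e
rec-deterministic (rec-zero d) (rec-zero e) = ⇓-deterministic d e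
rec-deterministic (rec-suc d₁ d₂) (rec-suc e₁ e₂) with refl ← rec-deterministic d₁ e₁ = ⇓-deterministic d₂ e₂
mu-deterministic (mu-found d) (mu-found e) = refl
mu-deterministic (mu-found d) (mu-next e _) with () ← ⇓-deterministic d e
mu-deterministic (mu-next d _) (mu-found e) with () ← ⇓-deterministic d e
mu-deterministic (mu-next _ d) (mu-next _ e) = mu-deterministic d e

⇓-subst : ∀ {c x y y′} → c ⊢ x ⇓ y → y ≡ y′ → c ⊢ x ⇓ y′
⇓-subst d refl = d

>>=-just-inv : ∀ {m : Maybe ℕ} {f : ℕ → Maybe ℕ} {y} → (m >>= f) ≡ just y → ∃ λ z → m ≡ just z × f z ≡ just y
>>=-just-inv {just z} e = z , refl , e

>>=-just : ∀ {m : Maybe ℕ} {f : ℕ → Maybe ℕ} {z y} → m ≡ just z → f z ≡ just y → (m >>= f) ≡ just y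
>>=-just refl e = e

eval-sound : ∀ k c x y → eval k c x ≡ just y → c ⊢ x ⇓ y
recIter-sound : ∀ k f g x n y → recIter (eval k f) (eval k g) x n ≡ just y → RecRun f g x n y
muSearch-sound : ∀ k f x b i y → muSearch (λ j → eval k f (pair x j)) b i ≡ just y → MuRun f x i y
eval-sound (suc k) Z x y refl = ⇓Z
eval-sound (suc k) S x y refl = ⇓S
eval-sound (suc k) I x y refl = ⇓I
eval-sound (suc k) L x y refl = ⇓L
eval-sound (suc k) R x y refl = ⇓R
eval-sound (suc k) (C f g) x y e with z , e₁ , e₂ ← >>=-just-inv {eval k g x} e =
  ⇓C (eval-sound k g x z e₁) (eval-sound k f z y e₂)
eval-sound (suc k) (P f g) x y e with a , e₁ , e₂ ← >>=-just-inv {eval k f x} e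
                                 with b , e₃ , refl ← >>=-just-inv {eval k g x} e₂ =
  ⇓P (eval-sound k f x a e₁) (eval-sound k g x b e₃)
eval-sound (suc k) (Rec f g) x y e = ⇓Rec (recIter-sound k f g (fst x) (snd x) y e)
eval-sound (suc k) (Mu f) x y e = ⇓Mu (muSearch-sound k f x (suc k) 0 y e)
recIter-sound k f g x zero y e = rec-zero (eval-sound k f x y e)
recIter-sound k f g x (suc n) y e with h , e₁ , e₂ ← >>=-just-inv {recIter (eval k f) (eval k g) x n} e =
  rec-suc (recIter-sound k f g x n h e₁) (eval-sound k g _ y e₂)
muSearch-sound k f x (suc b) i y e with eval k f (pair x i) in eq
muSearch-sound k f x (suc b) i y refl | just zero    = mu-found (eval-sound k f _ 0 eq)
muSearch-sound k f x (suc b) i y e    | just (suc v) = mu-next (eval-sound k f _ (suc v) eq) (muSearch-sound k f x b (suc i) y e)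

eval-mono : ∀ {k k′} c x {y} → k ≤ k′ → eval k c x ≡ just y → eval k′ c x ≡ just y
recIter-mono : ∀ {k k′} f g x n {y} → k ≤ k′ →
  recIter (eval k f) (eval k g) x n ≡ just y → recIter (eval k′ f) (eval k′ g) x n ≡ just y
muSearch-mono : ∀ (h h′ : ℕ → Maybe ℕ) → (∀ z {w} → h z ≡ just w → h′ z ≡ just w) →
  ∀ {b b′} i {y} → b ≤ b′ → muSearch h b i ≡ just y → muSearch h′ b′ i ≡ just y
eval-mono {suc k} {suc k′} Z x p e = e
eval-mono {suc k} {suc k′} S x p e = e
eval-mono {suc k} {suc k′} I x p e = e
eval-mono {suc k} {suc k′} L x p e = e
eval-mono {suc k} {suc k′} R x p e = e
eval-mono {suc k} {suc k′} (C f g) x (s≤s p) e with z , e₁ , e₂ ← >>=-just-inv {eval k g x} e =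
  >>=-just (eval-mono g x p e₁) (eval-mono f z p e₂)
eval-mono {suc k} {suc k′} (P f g) x (s≤s p) e with a , e₁ , e₂ ← >>=-just-inv {eval k f x} e
                                              with b , e₃ , refl ← >>=-just-inv {eval k g x} e₂ =
  >>=-just (eval-mono f x p e₁) (>>=-just (eval-mono g x p e₃) refl)
eval-mono {suc k} {suc k′} (Rec f g) x (s≤s p) e = recIter-mono f g (fst x) (snd x) p e
eval-mono {suc k} {suc k′} (Mu f) x (s≤s p) e =
  muSearch-mono _ _ (λ z → eval-mono f (pair x z) p) 0 (s≤s p) e
recIter-mono f g x zero p e = eval-mono f x p e
recIter-mono {k} f g x (suc n) p e with h , e₁ , e₂ ← >>=-just-inv {recIter (eval k f) (eval k g) x n} e =
  >>=-just (recIter-mono f g x n p e₁) (eval-mono g _ p e₂)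
muSearch-mono h h′ hh {suc b} {suc b′} i (s≤s p) e with h i in eq
muSearch-mono h h′ hh {suc b} {suc b′} i (s≤s p) refl | just zero rewrite hh i eq = refl
muSearch-mono h h′ hh {suc b} {suc b′} i (s≤s p) e | just (suc v) rewrite hh i eq =
  muSearch-mono h h′ hh (suc i) p e

eval-mono-⊔ˡ : ∀ k k′ c x {y} → eval k c x ≡ just y → eval (k ⊔ k′) c x ≡ just y
eval-mono-⊔ˡ k k′ c x = eval-mono c x (m≤m⊔n k k′)

eval-mono-⊔ʳ : ∀ k k′ c x {y} → eval k′ c x ≡ just y → eval (k ⊔ k′) c x ≡ just y
eval-mono-⊔ʳ k k′ c x = eval-mono c x (m≤n⊔m k k′)

muSearch-found : ∀ (h : ℕ → Maybe ℕ) {b i} → h i ≡ just 0 → muSearch h (suc b) i ≡ just i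
muSearch-found h eq rewrite eq = refl

muSearch-next : ∀ (h : ℕ → Maybe ℕ) {b i v} → h i ≡ just (suc v) → muSearch h (suc b) i ≡ muSearch h b (suc i)
muSearch-next h eq rewrite eq = refl

eval-complete : ∀ {c x y} → c ⊢ x ⇓ y → ∃ λ k → eval k c x ≡ just y
recIter-complete : ∀ {f g x n y} → RecRun f g x n y → ∃ λ k → recIter (eval k f) (eval k g) x n ≡ just y
muSearch-complete : ∀ {f x i y} → MuRun f x i y → ∃ λ k → muSearch (λ j → eval k f (pair x j)) k i ≡ just y
eval-complete ⇓Z = 1 , refl
eval-complete ⇓S = 1 , refl
eval-complete ⇓I = 1 , refl
eval-complete ⇓L = 1 , refl
eval-complete ⇓R = 1 , refl
eval-complete {C f g} {x} (⇓C {z = z} d₁ d₂) with k₁ , e₁ ← eval-complete d₁ | k₂ , e₂ ← eval-complete d₂ =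
  suc (k₁ ⊔ k₂) , >>=-just (eval-mono-⊔ˡ k₁ k₂ g x e₁) (eval-mono-⊔ʳ k₁ k₂ f z e₂)
eval-complete {P f g} {x} (⇓P d₁ d₂) with k₁ , e₁ ← eval-complete d₁ | k₂ , e₂ ← eval-complete d₂ =
  suc (k₁ ⊔ k₂) , >>=-just (eval-mono-⊔ˡ k₁ k₂ f x e₁) (>>=-just (eval-mono-⊔ʳ k₁ k₂ g x e₂) refl)
eval-complete (⇓Rec d) with k , e ← recIter-complete d = suc k , e
eval-complete (⇓Mu d) with k , e ← muSearch-complete d = suc k , muSearch-mono _ _ (λ _ e′ → e′) 0 (n≤1+n k) e
recIter-complete (rec-zero d) = eval-complete d
recIter-complete {f} {g} {x} {suc n} (rec-suc d₁ d₂) with k₁ , e₁ ← recIter-complete d₁ | k₂ , e₂ ← eval-complete d₂ =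
  k₁ ⊔ k₂ , >>=-just (recIter-mono f g x n (m≤m⊔n k₁ k₂) e₁) (eval-mono-⊔ʳ k₁ k₂ g _ e₂)
muSearch-complete {f} {x} {i} (mu-found d) with k , e ← eval-complete d =
  suc k , muSearch-found (λ j → eval (suc k) f (pair x j)) {i = i} (eval-mono f _ (n≤1+n k) e)
muSearch-complete {f} {x} {i} (mu-next d₁ d₂) with k₁ , e₁ ← eval-complete d₁ | k₂ , e₂ ← muSearch-complete d₂ =
  suc (k₁ ⊔ k₂) , trans
    (muSearch-next (λ j → eval (suc (k₁ ⊔ k₂)) f (pair x j)) {i = i} (eval-mono f _ (≤-trans (m≤m⊔n k₁ k₂) (n≤1+n _)) e₁))
    (muSearch-mono _ _ (λ z → eval-mono f (pair x z) (≤-trans (m≤n⊔m k₁ k₂) (n≤1+n _))) (suc i) (m≤n⊔m k₁ k₂) e₂)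

W⇒⇓ : ∀ {e y} → W e y → ∃ λ z → decode e ⊢ y ⇓ z
W⇒⇓ (z , k , ev) = z , eval-sound k _ _ z ev

⇓⇒W : ∀ {e y z} → decode e ⊢ y ⇓ z → W e y
⇓⇒W d = _ , eval-complete d

W⇔⇓ : ∀ e y → W e y ⇔ (∃ λ z → decode e ⊢ y ⇓ z)
W⇔⇓ e y = mk⇔ (W⇒⇓ {e}) (λ (_ , d) → ⇓⇒W {e} d)

computable-by : ∀ {f} c → (∀ n → c ⊢ n ⇓ f n) → Computable f
computable-by c d = enc c , λ n → eval-complete (subst (λ c′ → c′ ⊢ n ⇓ _) (sym (decode-enc c)) (d n))

program-of : ∀ {f} → Computable f → ∃ λ c → ∀ n → c ⊢ n ⇓ f n
program-of (e , h) = decode e , λ n → eval-sound (proj₁ (h n)) _ _ _ (proj₂ (h n))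

ifz : ℕ → ℕ → ℕ → ℕ
ifz zero    a b = a
ifz (suc _) a b = b

-- An opaque copy of pair, so that evaluating large expressions never unfolds Cantor pairing.
opaque
  ⟪_,_⟫ : ℕ → ℕ → ℕ
  ⟪_,_⟫ = pair

  ⟪⟫≡pair : ∀ a b → ⟪ a , b ⟫ ≡ pair a b
  ⟪⟫≡pair a b = refl

fst-⟪⟫ : ∀ a b → fst ⟪ a , b ⟫ ≡ a
fst-⟪⟫ a b = trans (cong fst (⟪⟫≡pair a b)) (fst-pair a b)

snd-⟪⟫ : ∀ a b → snd ⟪ a , b ⟫ ≡ b
snd-⟪⟫ a b = trans (cong snd (⟪⟫≡pair a b)) (snd-pair a b)

data Expr : ℕ → Set where
  var    : ∀ {n} → Fin n → Expr n
  lit    : ∀ {n} → ℕ → Expr n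
  sucᴱ   : ∀ {n} → Expr n → Expr n
  pairᴱ  : ∀ {n} → Expr n → Expr n → Expr n
  fstᴱ   : ∀ {n} → Expr n → Expr n
  sndᴱ   : ∀ {n} → Expr n → Expr n
  predᴱ  : ∀ {n} → Expr n → Expr n
  ifzᴱ   : ∀ {n} → Expr n → Expr n → Expr n → Expr n
  splitᴱ : ∀ {n} → Expr n → Expr (2 + n) → Expr n
  appᴱ   : ∀ {n} → Expr 1 → Expr n → Expr n
  foldᴱ  : ∀ {n} → Expr 1 → Expr n → Expr n → Expr n
  extᴱ   : ∀ {n} (f : ℕ → ℕ) (c : Code) → (∀ x → c ⊢ x ⇓ f x) → Expr n → Expr n

#_ : ∀ {n} (m : ℕ) → {True (m <? n)} → Expr n
(# m) {m<n} = var ((Fin.# m) {_} {m<n})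

⟦_⟧ : ∀ {n} → Expr n → Vec ℕ n → ℕ
⟦ var i ⟧          ρ = lookup ρ i
⟦ lit k ⟧          ρ = k
⟦ sucᴱ e ⟧         ρ = suc (⟦ e ⟧ ρ)
⟦ pairᴱ a b ⟧      ρ = ⟪ ⟦ a ⟧ ρ , ⟦ b ⟧ ρ ⟫
⟦ fstᴱ e ⟧         ρ = fst (⟦ e ⟧ ρ)
⟦ sndᴱ e ⟧         ρ = snd (⟦ e ⟧ ρ)
⟦ predᴱ e ⟧        ρ = pred (⟦ e ⟧ ρ)
⟦ ifzᴱ a b c ⟧     ρ = ifz (⟦ a ⟧ ρ) (⟦ b ⟧ ρ) (⟦ c ⟧ ρ)
⟦ splitᴱ v b ⟧     ρ = ⟦ b ⟧ (fst (⟦ v ⟧ ρ) ∷ snd (⟦ v ⟧ ρ) ∷ ρ)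
⟦ appᴱ f a ⟧       ρ = ⟦ f ⟧ (⟦ a ⟧ ρ ∷ [])
⟦ foldᴱ f i k ⟧    ρ = fold (⟦ i ⟧ ρ) (λ h → ⟦ f ⟧ (h ∷ [])) (⟦ k ⟧ ρ)
⟦ extᴱ f c _ a ⟧   ρ = f (⟦ a ⟧ ρ)

envCode : ∀ {n} → Vec ℕ n → ℕ
envCode []      = 0
envCode (v ∷ ρ) = pair v (envCode ρ)

const : ℕ → Code
const zero    = Z
const (suc n) = C S (const n)

const-⇓ : ∀ n {x} → const n ⊢ x ⇓ n
const-⇓ zero    = ⇓Z
const-⇓ (suc n) = ⇓C (const-⇓ n) ⇓S

compile : ∀ {n} → Expr n → Code
compile (var zero)       = L
compile (var (suc i))    = C (compile (var i)) R
compile (lit k)          = const k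
compile (sucᴱ e)         = C S (compile e)
compile (pairᴱ a b)      = P (compile a) (compile b)
compile (fstᴱ e)         = C L (compile e)
compile (sndᴱ e)         = C R (compile e)
compile (predᴱ e)        = C (Rec Z (C L R)) (P Z (compile e))
compile (ifzᴱ a b c)     = C (Rec (compile b) (C (compile c) L)) (P I (compile a))
compile (splitᴱ v b)     = C (compile b) (P (C L (compile v)) (P (C R (compile v)) I))
compile (appᴱ f a)       = C (compile f) (P (compile a) Z)
compile (foldᴱ f i k)    = C (Rec (compile i) (C (compile f) (P (C R R) Z))) (P I (compile k))
compile (extᴱ f c _ a)   = C c (compile a)

primrec : ℕ → (ℕ → ℕ → ℕ) → ℕ → ℕ
primrec z s zero    = z
primrec z s (suc m) = s m (primrec z s m)

RecRun-primrec : ∀ {f g x} (z : ℕ) (s : ℕ → ℕ → ℕ) → f ⊢ x ⇓ z →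
  (∀ m h → g ⊢ pair x (pair m h) ⇓ s m h) → ∀ n → RecRun f g x n (primrec z s n)
RecRun-primrec z s dz ds zero    = rec-zero dz
RecRun-primrec z s dz ds (suc n) = rec-suc (RecRun-primrec z s dz ds n) (ds n _)

⇓Rec-pair : ∀ {f g x n y} → RecRun f g x n y → Rec f g ⊢ pair x n ⇓ y
⇓Rec-pair {f} {g} {x} {n} {y} d = ⇓Rec (subst₂ (λ a b → RecRun f g a b y) (sym (fst-pair x n)) (sym (snd-pair x n)) d)

⇓L-pair : ∀ a b → L ⊢ pair a b ⇓ a
⇓L-pair a b = ⇓-subst ⇓L (fst-pair a b)

⇓R-pair : ∀ a b → R ⊢ pair a b ⇓ b
⇓R-pair a b = ⇓-subst ⇓R (snd-pair a b)

primrec-pred : ∀ n → primrec 0 (λ m _ → m) n ≡ pred n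
primrec-pred zero    = refl
primrec-pred (suc n) = refl

primrec-ifz : ∀ a b c → primrec b (λ _ _ → c) a ≡ ifz a b c
primrec-ifz zero    b c = refl
primrec-ifz (suc a) b c = refl

primrec-fold : ∀ z (f : ℕ → ℕ) n → primrec z (λ _ h → f h) n ≡ fold z f n
primrec-fold z f zero    = refl
primrec-fold z f (suc n) = cong f (primrec-fold z f n)

compile-correct : ∀ {n} (e : Expr n) (ρ : Vec ℕ n) → compile e ⊢ envCode ρ ⇓ ⟦ e ⟧ ρ
compile-correct (var zero)    (v ∷ ρ) = ⇓L-pair v (envCode ρ)
compile-correct (var (suc i)) (v ∷ ρ) = ⇓C (⇓R-pair v (envCode ρ)) (compile-correct (var i) ρ)
compile-correct (lit k)     ρ = const-⇓ k
compile-correct (sucᴱ e)    ρ = ⇓C (compile-correct e ρ) ⇓S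
compile-correct (pairᴱ a b) ρ = ⇓-subst (⇓P (compile-correct a ρ) (compile-correct b ρ)) (sym (⟪⟫≡pair _ _))
compile-correct (fstᴱ e)    ρ = ⇓C (compile-correct e ρ) ⇓L
compile-correct (sndᴱ e)    ρ = ⇓C (compile-correct e ρ) ⇓R
compile-correct (predᴱ e)   ρ = ⇓C (⇓P ⇓Z (compile-correct e ρ)) (⇓-subst (⇓Rec-pair {x = 0}
  (RecRun-primrec 0 (λ m _ → m) ⇓Z (λ m h → ⇓C (⇓R-pair 0 (pair m h)) (⇓L-pair m h)) (⟦ e ⟧ ρ)))
  (primrec-pred (⟦ e ⟧ ρ)))
compile-correct (ifzᴱ a b c) ρ = ⇓C (⇓P ⇓I (compile-correct a ρ)) (⇓-subst (⇓Rec-pair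
  (RecRun-primrec (⟦ b ⟧ ρ) (λ _ _ → ⟦ c ⟧ ρ) (compile-correct b ρ)
    (λ m h → ⇓C (⇓L-pair (envCode ρ) (pair m h)) (compile-correct c ρ)) (⟦ a ⟧ ρ)))
  (primrec-ifz (⟦ a ⟧ ρ) (⟦ b ⟧ ρ) (⟦ c ⟧ ρ)))
compile-correct (splitᴱ v b) ρ = ⇓C (⇓P (⇓C (compile-correct v ρ) ⇓L) (⇓P (⇓C (compile-correct v ρ) ⇓R) ⇓I))
  (compile-correct b (fst (⟦ v ⟧ ρ) ∷ snd (⟦ v ⟧ ρ) ∷ ρ))
compile-correct (appᴱ f a) ρ = ⇓C (⇓P (compile-correct a ρ) ⇓Z) (compile-correct f (⟦ a ⟧ ρ ∷ []))
compile-correct (foldᴱ f i k) ρ = ⇓C (⇓P ⇓I (compile-correct k ρ)) (⇓-subst (⇓Rec-pair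
  (RecRun-primrec (⟦ i ⟧ ρ) (λ _ h → ⟦ f ⟧ (h ∷ [])) (compile-correct i ρ)
    (λ m h → ⇓C (⇓P (⇓C (⇓R-pair (envCode ρ) (pair m h)) (⇓R-pair m h)) ⇓Z) (compile-correct f (h ∷ []))) (⟦ k ⟧ ρ)))
  (primrec-fold (⟦ i ⟧ ρ) (λ h → ⟦ f ⟧ (h ∷ [])) (⟦ k ⟧ ρ)))
compile-correct (extᴱ f c d a) ρ = ⇓C (compile-correct a ρ) (d _)

program : Expr 1 → Code
program e = C (compile e) (P I Z)

program-correct : ∀ e x → program e ⊢ x ⇓ ⟦ e ⟧ (x ∷ [])
program-correct e x = ⇓C (⇓P ⇓I ⇓Z) (compile-correct e (x ∷ []))

MuRun-sound : ∀ {f x i y} → MuRun f x i y → f ⊢ pair x y ⇓ 0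
MuRun-sound (mu-found d) = d
MuRun-sound (mu-next _ d) = MuRun-sound d

MuRun-complete : ∀ {f x} (F : ℕ → ℕ) → (∀ i → f ⊢ pair x i ⇓ F i) →
  ∀ t i → F (i + t) ≡ 0 → ∃ λ y → MuRun f x i y
MuRun-complete F d t i F0 with F i in eq
MuRun-complete F d t i F0 | zero = i , mu-found (⇓-subst (d i) eq)
MuRun-complete F d zero i F0 | suc v with () ← trans (trans (sym eq) (cong F (sym (+-identityʳ i)))) F0
MuRun-complete F d (suc t) i F0 | suc v with y , m ← MuRun-complete F d t (suc i) (trans (cong F (sym (+-suc i t))) F0) =
  y , mu-next (⇓-subst (d i) eq) m

Mu-program-halts : ∀ e x t → ⟦ e ⟧ (pair x t ∷ []) ≡ 0 → ∃ λ y → Mu (program e) ⊢ x ⇓ y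
Mu-program-halts e x t e0 with y , m ← MuRun-complete _ (λ i → program-correct e (pair x i)) t 0 e0 = y , ⇓Mu m

Mu-program-zero : ∀ e {x y} → Mu (program e) ⊢ x ⇓ y → ⟦ e ⟧ (pair x y ∷ []) ≡ 0
Mu-program-zero e (⇓Mu m) = ⇓-deterministic (program-correct e _) (MuRun-sound m)

caseᴱ : ∀ {n} → Expr n → List (Expr n) → Expr n → Expr n
caseᴱ t []       d = d
caseᴱ t (a ∷ as) d = ifzᴱ t a (caseᴱ (predᴱ t) as d)

-- A state ⟪ 0 , ⟪ c , ⟪ x , K ⟫ ⟫ ⟫ evaluates program number c at x and ⟪ 1 , ⟪ y , K ⟫ ⟫
-- returns y, in both cases to the stack K, which is 0 (empty) or suc ⟪ frame , K′ ⟫.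
-- A frame ⟪ tag , data ⟫ records what remains to be done with the returned value.

evalᴱ : ∀ {n} → Expr n → Expr n → Expr n → Expr n
evalᴱ c x K = pairᴱ (lit 0) (pairᴱ c (pairᴱ x K))

returnᴱ : ∀ {n} → Expr n → Expr n → Expr n
returnᴱ y K = pairᴱ (lit 1) (pairᴱ y K)

pushᴱ : ∀ {n} → Expr n → Expr n → Expr n
pushᴱ fr K = sucᴱ (pairᴱ fr K)

compFrameᴱ : ∀ {n} → Expr n → Expr n
compFrameᴱ f = pairᴱ (lit 0) f

pairLeftFrameᴱ : ∀ {n} → Expr n → Expr n → Expr n
pairLeftFrameᴱ g x = pairᴱ (lit 1) (pairᴱ g x)

pairRightFrameᴱ : ∀ {n} → Expr n → Expr n
pairRightFrameᴱ a = pairᴱ (lit 2) a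

recFrameᴱ : ∀ {n} → Expr n → Expr n → Expr n → Expr n → Expr n
recFrameᴱ g x i rem = pairᴱ (lit 3) (pairᴱ g (pairᴱ x (pairᴱ i rem)))

muFrameᴱ : ∀ {n} → Expr n → Expr n → Expr n → Expr n
muFrameᴱ f x i = pairᴱ (lit 4) (pairᴱ f (pairᴱ x i))

-- Variables: 0 tag and 1 rest of the program number, 2 argument, 3 stack.
evalBranch : Expr 7
evalBranch = caseᴱ (# 0)
  ( returnᴱ (lit 0) (# 3)
  ∷ returnᴱ (sucᴱ (# 2)) (# 3)
  ∷ returnᴱ (# 2) (# 3)
  ∷ returnᴱ (fstᴱ (# 2)) (# 3)
  ∷ returnᴱ (sndᴱ (# 2)) (# 3)
  ∷ evalᴱ (sndᴱ (# 1)) (# 2) (pushᴱ (compFrameᴱ (fstᴱ (# 1))) (# 3))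
  ∷ evalᴱ (fstᴱ (# 1)) (# 2) (pushᴱ (pairLeftFrameᴱ (sndᴱ (# 1)) (# 2)) (# 3))
  ∷ evalᴱ (fstᴱ (# 1)) (fstᴱ (# 2)) (pushᴱ (recFrameᴱ (sndᴱ (# 1)) (fstᴱ (# 2)) (lit 0) (sndᴱ (# 2))) (# 3))
  ∷ evalᴱ (# 1) (pairᴱ (# 2) (lit 0)) (pushᴱ (muFrameᴱ (# 1) (# 2) (lit 0)) (# 3))
  ∷ [])
  (returnᴱ (lit 0) (# 3))

-- Variables: 0 i, 1 rem, 2 x, 4 g, 9 stack below the frame, 10 returned value.
recReturn : Expr 13
recReturn = ifzᴱ (# 1) (returnᴱ (# 10) (# 9))
  (evalᴱ (# 4) (pairᴱ (# 2) (pairᴱ (# 0) (# 10))) (pushᴱ (recFrameᴱ (# 4) (# 2) (sucᴱ (# 0)) (predᴱ (# 1))) (# 9)))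

-- Variables: 0 x, 1 i, 2 f, 7 stack below the frame, 8 returned value.
muReturn : Expr 11
muReturn = ifzᴱ (# 8) (returnᴱ (# 1) (# 7))
  (evalᴱ (# 2) (pairᴱ (# 0) (sucᴱ (# 1))) (pushᴱ (muFrameᴱ (# 2) (# 0) (sucᴱ (# 1))) (# 7)))

-- Variables: 0 tag and 1 data of the frame, 3 stack below it, 4 returned value.
returnBranch : Expr 7
returnBranch = caseᴱ (# 0)
  ( evalᴱ (# 1) (# 4) (# 3)
  ∷ evalᴱ (fstᴱ (# 1)) (sndᴱ (# 1)) (pushᴱ (pairRightFrameᴱ (# 4)) (# 3))
  ∷ returnᴱ (pairᴱ (# 1) (# 4)) (# 3)
  ∷ splitᴱ (# 1) (splitᴱ (# 1) (splitᴱ (# 1) recReturn))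
  ∷ splitᴱ (# 1) (splitᴱ (# 1) muReturn)
  ∷ [])
  (returnᴱ (# 4) (# 3))

evalStepᴱ : Expr 1
evalStepᴱ = splitᴱ (# 0) (splitᴱ (# 1) (splitᴱ (# 2) evalBranch))

returnOnᴱ : Expr 3
returnOnᴱ = ifzᴱ (# 1) (returnᴱ (# 0) (lit 0)) (splitᴱ (predᴱ (# 1)) (splitᴱ (# 0) returnBranch))

returnStepᴱ : Expr 1
returnStepᴱ = splitᴱ (# 0) returnOnᴱ

stepOnᴱ : Expr 3
stepOnᴱ = ifzᴱ (# 0) (appᴱ evalStepᴱ (# 1)) (appᴱ returnStepᴱ (# 1))

stepᴱ : Expr 1
stepᴱ = splitᴱ (# 0) stepOnᴱ

haltedOnᴱ : Expr 3
haltedOnᴱ = ifzᴱ (# 0) (lit 1) (ifzᴱ (sndᴱ (# 1)) (lit 0) (lit 1))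

haltFlagᴱ : Expr 1
haltFlagᴱ = splitᴱ (# 0) haltedOnᴱ

split-⟪⟫ : ∀ {n} (e : Expr n) (b : Expr (2 + n)) (ρ : Vec ℕ n) {a c} → ⟦ e ⟧ ρ ≡ ⟪ a , c ⟫ →
  ⟦ splitᴱ e b ⟧ ρ ≡ ⟦ b ⟧ (a ∷ c ∷ ρ)
split-⟪⟫ e b ρ {a} {c} eq rewrite eq = cong₂ (λ u w → ⟦ b ⟧ (u ∷ w ∷ ρ)) (fst-⟪⟫ a c) (snd-⟪⟫ a c)

split-pair : ∀ {n} (e : Expr n) (b : Expr (2 + n)) (ρ : Vec ℕ n) {a c} → ⟦ e ⟧ ρ ≡ pair a c →
  ⟦ splitᴱ e b ⟧ ρ ≡ ⟦ b ⟧ (a ∷ c ∷ ρ)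
split-pair e b ρ {a} {c} eq rewrite eq = cong₂ (λ u w → ⟦ b ⟧ (u ∷ w ∷ ρ)) (fst-pair a c) (snd-pair a c)

evalState : ℕ → ℕ → ℕ → ℕ
evalState c x K = ⟪ 0 , ⟪ c , ⟪ x , K ⟫ ⟫ ⟫

returnState : ℕ → ℕ → ℕ
returnState y K = ⟪ 1 , ⟪ y , K ⟫ ⟫

push : ℕ → ℕ → ℕ
push fr K = suc ⟪ fr , K ⟫

compFrame : ℕ → ℕ
compFrame f = ⟪ 0 , f ⟫

pairLeftFrame : ℕ → ℕ → ℕ
pairLeftFrame g x = ⟪ 1 , ⟪ g , x ⟫ ⟫

pairRightFrame : ℕ → ℕ
pairRightFrame a = ⟪ 2 , a ⟫

recFrame : ℕ → ℕ → ℕ → ℕ → ℕ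
recFrame g x i rem = ⟪ 3 , ⟪ g , ⟪ x , ⟪ i , rem ⟫ ⟫ ⟫ ⟫

muFrame : ℕ → ℕ → ℕ → ℕ
muFrame f x i = ⟪ 4 , ⟪ f , ⟪ x , i ⟫ ⟫ ⟫

opaque
  step : ℕ → ℕ
  step s = ⟦ stepᴱ ⟧ (s ∷ [])

  haltFlag : ℕ → ℕ
  haltFlag s = ⟦ haltFlagᴱ ⟧ (s ∷ [])

  ⟦stepᴱ⟧ : ∀ s → ⟦ stepᴱ ⟧ (s ∷ []) ≡ step s
  ⟦stepᴱ⟧ s = refl

  ⟦haltFlagᴱ⟧ : ∀ s → ⟦ haltFlagᴱ ⟧ (s ∷ []) ≡ haltFlag s
  ⟦haltFlagᴱ⟧ s = refl

  step-eval : ∀ {c t r} x K → unpair c ≡ (t , r) →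
    step (evalState c x K) ≡ ⟦ evalBranch ⟧ (t ∷ r ∷ x ∷ K ∷ c ∷ ⟪ x , K ⟫ ∷ ⟪ c , ⟪ x , K ⟫ ⟫ ∷ [])
  step-eval {c} x K eq = begin
    step (evalState c x K)
      ≡⟨ split-⟪⟫ (# 0) stepOnᴱ (evalState c x K ∷ []) refl ⟩
    ⟦ evalStepᴱ ⟧ (cxK ∷ [])
      ≡⟨ split-⟪⟫ (# 0) (splitᴱ (# 1) (splitᴱ (# 2) evalBranch)) (cxK ∷ []) refl ⟩
    _ ≡⟨ split-⟪⟫ (# 1) (splitᴱ (# 2) evalBranch) (c ∷ ⟪ x , K ⟫ ∷ cxK ∷ []) refl ⟩
    ⟦ evalBranch ⟧ (fst c ∷ snd c ∷ x ∷ K ∷ c ∷ ⟪ x , K ⟫ ∷ cxK ∷ [])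
      ≡⟨ cong (λ (p : ℕ × ℕ) → ⟦ evalBranch ⟧ (proj₁ p ∷ proj₂ p ∷ x ∷ K ∷ c ∷ ⟪ x , K ⟫ ∷ cxK ∷ [])) eq ⟩
    _ ∎
    where
    open ≡-Reasoning
    cxK : ℕ
    cxK = ⟪ c , ⟪ x , K ⟫ ⟫

  step-return : ∀ y ft fd K → let K′ = push ⟪ ft , fd ⟫ K in
    step (returnState y K′) ≡ ⟦ returnBranch ⟧ (ft ∷ fd ∷ ⟪ ft , fd ⟫ ∷ K ∷ y ∷ K′ ∷ ⟪ y , K′ ⟫ ∷ [])
  step-return y ft fd K = begin
    step (returnState y K′)
      ≡⟨ split-⟪⟫ (# 0) stepOnᴱ (returnState y K′ ∷ []) refl ⟩
    ⟦ returnStepᴱ ⟧ (⟪ y , K′ ⟫ ∷ [])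
      ≡⟨ split-⟪⟫ (# 0) returnOnᴱ (⟪ y , K′ ⟫ ∷ []) refl ⟩
    _ ≡⟨ split-⟪⟫ (predᴱ (# 1)) (splitᴱ (# 0) returnBranch) (y ∷ K′ ∷ ⟪ y , K′ ⟫ ∷ []) refl ⟩
    _ ≡⟨ split-⟪⟫ (# 0) returnBranch (⟪ ft , fd ⟫ ∷ K ∷ y ∷ K′ ∷ ⟪ y , K′ ⟫ ∷ []) refl ⟩
    _ ∎
    where
    open ≡-Reasoning
    K′ : ℕ
    K′ = push ⟪ ft , fd ⟫ K

  haltFlag-eval : ∀ c x K → haltFlag (evalState c x K) ≡ 1
  haltFlag-eval c x K = split-⟪⟫ (# 0) haltedOnᴱ (evalState c x K ∷ []) refl

  haltFlag-return-push : ∀ y fr K → haltFlag (returnState y (push fr K)) ≡ 1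
  haltFlag-return-push y fr K = trans (split-⟪⟫ (# 0) haltedOnᴱ (returnState y (push fr K) ∷ []) refl)
    (cong (λ u → ifz u 0 1) (snd-⟪⟫ y (push fr K)))

  haltFlag-return-empty : ∀ y → haltFlag (returnState y 0) ≡ 0
  haltFlag-return-empty y = trans (split-⟪⟫ (# 0) haltedOnᴱ (returnState y 0 ∷ []) refl)
    (cong (λ u → ifz u 0 1) (snd-⟪⟫ y 0))

module _ {c r : ℕ} (x K : ℕ) where
  step-Z : unpair c ≡ (0 , r) → step (evalState c x K) ≡ returnState 0 K
  step-Z = step-eval x K

  step-junk : ∀ {t} → unpair c ≡ (9 + t , r) → step (evalState c x K) ≡ returnState 0 K
  step-junk = step-eval x K

  step-S : unpair c ≡ (1 , r) → step (evalState c x K) ≡ returnState (suc x) K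
  step-S = step-eval x K

  step-I : unpair c ≡ (2 , r) → step (evalState c x K) ≡ returnState x K
  step-I = step-eval x K

  step-L : unpair c ≡ (3 , r) → step (evalState c x K) ≡ returnState (fst x) K
  step-L = step-eval x K

  step-R : unpair c ≡ (4 , r) → step (evalState c x K) ≡ returnState (snd x) K
  step-R = step-eval x K

  step-C : unpair c ≡ (5 , r) → step (evalState c x K) ≡ evalState (snd r) x (push (compFrame (fst r)) K)
  step-C = step-eval x K

  step-P : unpair c ≡ (6 , r) → step (evalState c x K) ≡ evalState (fst r) x (push (pairLeftFrame (snd r) x) K)
  step-P = step-eval x K

  step-Rec : unpair c ≡ (7 , r) →
    step (evalState c x K) ≡ evalState (fst r) (fst x) (push (recFrame (snd r) (fst x) 0 (snd x)) K)
  step-Rec = step-eval x K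

  step-Mu : unpair c ≡ (8 , r) → step (evalState c x K) ≡ evalState r (pair x 0) (push (muFrame r x 0) K)
  step-Mu eq = trans (step-eval x K eq) (cong (λ z → evalState r z (push (muFrame r x 0) K)) (⟪⟫≡pair x 0))

step-return-comp : ∀ y f K → step (returnState y (push (compFrame f) K)) ≡ evalState f y K
step-return-comp y f K = step-return y 0 f K

step-return-pairLeft : ∀ y g x K → step (returnState y (push (pairLeftFrame g x) K)) ≡ evalState g x (push (pairRightFrame y) K)
step-return-pairLeft y g x K = trans (step-return y 1 ⟪ g , x ⟫ K)
  (cong₂ (λ a b → evalState a b (push (pairRightFrame y) K)) (fst-⟪⟫ g x) (snd-⟪⟫ g x))

step-return-pairRight : ∀ y a K → step (returnState y (push (pairRightFrame a) K)) ≡ returnState (pair a y) K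
step-return-pairRight y a K = trans (step-return y 2 a K) (cong (λ z → returnState z K) (⟪⟫≡pair a y))

step-return-rec : ∀ y g x i rem K → step (returnState y (push (recFrame g x i rem) K)) ≡
  ifz rem (returnState y K) (evalState g (pair x (pair i y)) (push (recFrame g x (suc i) (pred rem)) K))
step-return-rec y g x i rem K = begin
  step (returnState y (push (recFrame g x i rem) K))
    ≡⟨ step-return y 3 d K ⟩
  _ ≡⟨ split-⟪⟫ (# 1) (splitᴱ (# 1) (splitᴱ (# 1) recReturn)) ρ refl ⟩
  _ ≡⟨ split-⟪⟫ (# 1) (splitᴱ (# 1) recReturn) (g ∷ ⟪ x , ⟪ i , rem ⟫ ⟫ ∷ ρ) refl ⟩
  _ ≡⟨ split-⟪⟫ (# 1) recReturn (x ∷ ⟪ i , rem ⟫ ∷ g ∷ ⟪ x , ⟪ i , rem ⟫ ⟫ ∷ ρ) refl ⟩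
  ifz rem (returnState y K) (evalState g ⟪ x , ⟪ i , y ⟫ ⟫ K′)
    ≡⟨ cong (λ z → ifz rem (returnState y K) (evalState g z K′)) (trans (cong ⟪ x ,_⟫ (⟪⟫≡pair i y)) (⟪⟫≡pair x _)) ⟩
  _ ∎
  where
  open ≡-Reasoning
  d : ℕ
  d = ⟪ g , ⟪ x , ⟪ i , rem ⟫ ⟫ ⟫
  ρ : Vec ℕ 7
  ρ = 3 ∷ d ∷ ⟪ 3 , d ⟫ ∷ K ∷ y ∷ push ⟪ 3 , d ⟫ K ∷ ⟪ y , push ⟪ 3 , d ⟫ K ⟫ ∷ []
  K′ : ℕ
  K′ = push (recFrame g x (suc i) (pred rem)) K

step-return-mu : ∀ y f x i K → step (returnState y (push (muFrame f x i) K)) ≡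
  ifz y (returnState i K) (evalState f (pair x (suc i)) (push (muFrame f x (suc i)) K))
step-return-mu y f x i K = begin
  step (returnState y (push (muFrame f x i) K))
    ≡⟨ step-return y 4 d K ⟩
  _ ≡⟨ split-⟪⟫ (# 1) (splitᴱ (# 1) muReturn) ρ refl ⟩
  _ ≡⟨ split-⟪⟫ (# 1) muReturn (f ∷ ⟪ x , i ⟫ ∷ ρ) refl ⟩
  ifz y (returnState i K) (evalState f ⟪ x , suc i ⟫ K′)
    ≡⟨ cong (λ z → ifz y (returnState i K) (evalState f z K′)) (⟪⟫≡pair x (suc i)) ⟩
  _ ∎
  where
  open ≡-Reasoning
  d : ℕ
  d = ⟪ f , ⟪ x , i ⟫ ⟫
  ρ : Vec ℕ 7
  ρ = 4 ∷ d ∷ ⟪ 4 , d ⟫ ∷ K ∷ y ∷ push ⟪ 4 , d ⟫ K ∷ ⟪ y , push ⟪ 4 , d ⟫ K ⟫ ∷ []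
  K′ : ℕ
  K′ = push (muFrame f x (suc i)) K

_⟶_ : ℕ → ℕ → Set
s ⟶ s′ = step s ≡ s′

_⟶*_ : ℕ → ℕ → Set
_⟶*_ = Star _⟶_

⇓-runs : ∀ {c′ x y} → c′ ⊢ x ⇓ y → ∀ {c} → c Encodes c′ → ∀ K → evalState c x K ⟶* returnState y K
RecRun-runs : ∀ {f g x n y} → RecRun f g x n y → ∀ {fc gc} → fc Encodes f → gc Encodes g → ∀ K rem →
  evalState fc x (push (recFrame gc x 0 (rem + n)) K) ⟶* returnState y (push (recFrame gc x n rem) K)
MuRun-runs : ∀ {f x i y} → MuRun f x i y → ∀ {fc} → fc Encodes f → ∀ K →
  evalState fc (pair x i) (push (muFrame fc x i) K) ⟶* returnState y K
⇓-runs ⇓Z (#Z eq)    K = step-Z _ K eq ◅ done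
⇓-runs ⇓Z (#junk eq) K = step-junk _ K eq ◅ done
⇓-runs ⇓S (#S eq)    K = step-S _ K eq ◅ done
⇓-runs ⇓I (#I eq)    K = step-I _ K eq ◅ done
⇓-runs ⇓L (#L eq)    K = step-L _ K eq ◅ done
⇓-runs ⇓R (#R eq)    K = step-R _ K eq ◅ done
⇓-runs (⇓C {z = z} dg df) (#C {r} eq ef eg) K =
  step-C _ K eq ◅ ⇓-runs dg eg _ ◅◅ step-return-comp z (fst r) K ◅ ⇓-runs df ef K
⇓-runs {x = x} (⇓P {a = a} {b} df dg) (#P {r} eq ef eg) K =
  step-P _ K eq ◅ ⇓-runs df ef _ ◅◅ step-return-pairLeft a (snd r) x K ◅
  ⇓-runs dg eg _ ◅◅ step-return-pairRight b a K ◅ done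
⇓-runs {x = x} {y} (⇓Rec d) (#Rec {r} eq ef eg) K =
  step-Rec _ K eq ◅ RecRun-runs d ef eg K 0 ◅◅ step-return-rec y (snd r) (fst x) (snd x) 0 K ◅ done
⇓-runs (⇓Mu d) (#Mu eq ef) K = step-Mu _ K eq ◅ MuRun-runs d ef K
RecRun-runs (rec-zero d) ef eg K rem rewrite +-identityʳ rem = ⇓-runs d ef _
RecRun-runs {x = x} (rec-suc {n} {h} d dg) {fc} {gc} ef eg K rem =
  subst (λ m → evalState fc x (push (recFrame gc x 0 m) K) ⟶* returnState h (push (recFrame gc x n (suc rem)) K))
    (sym (+-suc rem n)) (RecRun-runs d ef eg K (suc rem))
  ◅◅ step-return-rec h gc x n (suc rem) K ◅ ⇓-runs dg eg _
MuRun-runs {x = x} {i} (mu-found d) {fc} ef K = ⇓-runs d ef _ ◅◅ step-return-mu 0 fc x i K ◅ done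
MuRun-runs {x = x} {i} (mu-next {v = v} d m) {fc} ef K =
  ⇓-runs d ef _ ◅◅ step-return-mu (suc v) fc x i K ◅ MuRun-runs m ef K

run : ℕ → ℕ → ℕ
run n s = iterate step s n

HaltedAfter : ℕ → ℕ → Set
HaltedAfter n s = haltFlag (run n s) ≡ 0

HaltedAfter-step : ∀ n {s s′} → s ⟶ s′ → HaltedAfter (suc n) s → HaltedAfter n s′
HaltedAfter-step n e h = subst (λ s → HaltedAfter n s) e h

eval-not-halted : ∀ {c x K} → ¬ HaltedAfter 0 (evalState c x K)
eval-not-halted {c} {x} {K} h with () ← trans (sym (haltFlag-eval c x K)) h

return-push-not-halted : ∀ {y fr K} → ¬ HaltedAfter 0 (returnState y (push fr K))
return-push-not-halted {y} {fr} {K} h with () ← trans (sym (haltFlag-return-push y fr K)) h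

HaltedAfter-return : ∀ {r y fr K s′} → returnState y (push fr K) ⟶ s′ →
  HaltedAfter r (returnState y (push fr K)) → ∃ λ j → j < r × HaltedAfter j s′
HaltedAfter-return {zero}  e h = ⊥-elim (return-push-not-halted h)
HaltedAfter-return {suc j} e h = j , ≤-refl , HaltedAfter-step j e h

ReturnsWithin : (ℕ → Set) → ℕ → ℕ → Set
ReturnsWithin Q K n = ∃₂ λ y r → r ≤ n × Q y × HaltedAfter r (returnState y K)

returns-at-once : ∀ {c c′ x y K n} → c′ ⊢ x ⇓ y → evalState c x K ⟶ returnState y K →
  HaltedAfter (suc n) (evalState c x K) → ReturnsWithin (c′ ⊢ x ⇓_) K (suc n)
returns-at-once {n = n} d e h = _ , n , n≤1+n n , d , HaltedAfter-step n e h

halts⇒⇓ : ∀ {n} → Acc _<_ n → ∀ {c c′} → c Encodes c′ → ∀ x K →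
  HaltedAfter n (evalState c x K) → ReturnsWithin (c′ ⊢ x ⇓_) K n
halts⇒RecRun : ∀ {n} → Acc _<_ n → ∀ {f g gc x i rem h K} → gc Encodes g → RecRun f g x i h →
  HaltedAfter n (returnState h (push (recFrame gc x i rem) K)) → ReturnsWithin (RecRun f g x (i + rem)) K n
halts⇒MuRun : ∀ {n} → Acc _<_ n → ∀ {f fc x i w K} → fc Encodes f → f ⊢ pair x i ⇓ w →
  HaltedAfter n (returnState w (push (muFrame fc x i) K)) → ReturnsWithin (MuRun f x i) K n

halts⇒⇓ {zero} _ _ x K h = ⊥-elim (eval-not-halted h)
halts⇒⇓ {suc n} _ (#Z eq)    x K h = returns-at-once ⇓Z (step-Z x K eq) h
halts⇒⇓ {suc n} _ (#junk eq) x K h = returns-at-once ⇓Z (step-junk x K eq) h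
halts⇒⇓ {suc n} _ (#S eq)    x K h = returns-at-once ⇓S (step-S x K eq) h
halts⇒⇓ {suc n} _ (#I eq)    x K h = returns-at-once ⇓I (step-I x K eq) h
halts⇒⇓ {suc n} _ (#L eq)    x K h = returns-at-once ⇓L (step-L x K eq) h
halts⇒⇓ {suc n} _ (#R eq)    x K h = returns-at-once ⇓R (step-R x K eq) h
halts⇒⇓ {suc n} (acc rs) (#C {r} eq ef eg) x K h
  with z , r₁ , r₁≤n , dg , hg ← halts⇒⇓ (rs (n<1+n n)) eg x _ (HaltedAfter-step n (step-C x K eq) h)
  with j , j<r₁ , hj ← HaltedAfter-return (step-return-comp z (fst r) K) hg
  with y , r₂ , r₂≤j , df , hf ← halts⇒⇓ (rs (<-≤-trans j<r₁ (m≤n⇒m≤1+n r₁≤n))) ef z K hj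
  = y , r₂ , ≤-trans r₂≤j (≤-trans (<⇒≤ j<r₁) (m≤n⇒m≤1+n r₁≤n)) , ⇓C dg df , hf
halts⇒⇓ {suc n} (acc rs) (#P {r} eq ef eg) x K h
  with a , r₁ , r₁≤n , df , hf ← halts⇒⇓ (rs (n<1+n n)) ef x _ (HaltedAfter-step n (step-P x K eq) h)
  with j , j<r₁ , hj ← HaltedAfter-return (step-return-pairLeft a (snd r) x K) hf
  with b , r₂ , r₂≤j , dg , hg ← halts⇒⇓ (rs (<-≤-trans j<r₁ (m≤n⇒m≤1+n r₁≤n))) eg x _ hj
  with j₂ , j₂<r₂ , hj₂ ← HaltedAfter-return (step-return-pairRight b a K) hg
  = pair a b , j₂ , ≤-trans (<⇒≤ j₂<r₂) (≤-trans r₂≤j (≤-trans (<⇒≤ j<r₁) (m≤n⇒m≤1+n r₁≤n))) , ⇓P df dg , hj₂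
halts⇒⇓ {suc n} (acc rs) (#Rec {r} eq ef eg) x K h
  with h₀ , r₁ , r₁≤n , df , hf ← halts⇒⇓ (rs (n<1+n n)) ef (fst x) _ (HaltedAfter-step n (step-Rec x K eq) h)
  with y , r₂ , r₂≤r₁ , dR , hR ← halts⇒RecRun (rs (s≤s r₁≤n)) eg (rec-zero df) hf
  = y , r₂ , ≤-trans r₂≤r₁ (m≤n⇒m≤1+n r₁≤n) , ⇓Rec dR , hR
halts⇒⇓ {suc n} (acc rs) (#Mu {r} eq ef) x K h
  with w , r₁ , r₁≤n , dw , hw ← halts⇒⇓ (rs (n<1+n n)) ef (pair x 0) _ (HaltedAfter-step n (step-Mu x K eq) h)
  with y , r₂ , r₂≤r₁ , dM , hM ← halts⇒MuRun (rs (s≤s r₁≤n)) ef dw hw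
  = y , r₂ , ≤-trans r₂≤r₁ (m≤n⇒m≤1+n r₁≤n) , ⇓Mu dM , hM

halts⇒RecRun {zero} _ _ _ h = ⊥-elim (return-push-not-halted h)
halts⇒RecRun {suc n} _ {gc = gc} {x} {i} {zero} {h₀} {K} eg d h =
  h₀ , n , n≤1+n n , subst (λ k → RecRun _ _ x k h₀) (sym (+-identityʳ i)) d ,
  HaltedAfter-step n (step-return-rec h₀ gc x i 0 K) h
halts⇒RecRun {suc n} (acc rs) {f} {g} {gc} {x} {i} {suc q} {h₀} {K} eg d h
  with h₁ , r₁ , r₁≤n , dg , hg ← halts⇒⇓ (rs (n<1+n n)) eg _ _ (HaltedAfter-step n (step-return-rec h₀ gc x i (suc q) K) h)
  with y , r₂ , r₂≤r₁ , dR , hR ← halts⇒RecRun (rs (s≤s r₁≤n)) eg (rec-suc d dg) hg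
  = y , r₂ , ≤-trans r₂≤r₁ (m≤n⇒m≤1+n r₁≤n) , subst (λ k → RecRun f g x k y) (sym (+-suc i q)) dR , hR

halts⇒MuRun {zero} _ _ _ h = ⊥-elim (return-push-not-halted h)
halts⇒MuRun {suc n} _ {fc = fc} {x} {i} {zero} {K} ef dw h =
  i , n , n≤1+n n , mu-found dw , HaltedAfter-step n (step-return-mu 0 fc x i K) h
halts⇒MuRun {suc n} (acc rs) {fc = fc} {x} {i} {suc v} {K} ef dw h
  with w , r₁ , r₁≤n , dw′ , hw ← halts⇒⇓ (rs (n<1+n n)) ef _ _ (HaltedAfter-step n (step-return-mu (suc v) fc x i K) h)
  with y , r₂ , r₂≤r₁ , dM , hM ← halts⇒MuRun (rs (s≤s r₁≤n)) ef dw′ hw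
  = y , r₂ , ≤-trans r₂≤r₁ (m≤n⇒m≤1+n r₁≤n) , mu-next dw dM , hM

⟶*-run : ∀ {s s′} → s ⟶* s′ → ∃ λ m → run m s ≡ s′
⟶*-run done = 0 , refl
⟶*-run (e ◅ p) with m , q ← ⟶*-run p = suc m , trans (cong (run m) e) q

haltingTest : ℕ → ℕ → ℕ → ℕ
haltingTest e y t = haltFlag (run t (evalState e y 0))

W⇒haltingTest : ∀ e y → W e y → ∃ λ t → haltingTest e y t ≡ 0
W⇒haltingTest e y w with z , d ← W⇒⇓ {e} w with m , q ← ⟶*-run (⇓-runs d (decode-encodes e) 0) =
  m , trans (cong haltFlag q) (haltFlag-return-empty z)

haltingTest⇒W : ∀ e y t → haltingTest e y t ≡ 0 → W e y
haltingTest⇒W e y t h with _ , _ , _ , d , _ ← halts⇒⇓ (<-wellFounded t) (decode-encodes e) y 0 h = ⇓⇒W {e} d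

fold-cong : ∀ {f g : ℕ → ℕ} → (∀ x → f x ≡ g x) → ∀ z n → fold z f n ≡ fold z g n
fold-cong         f≗g z zero    = refl
fold-cong {f} {g} f≗g z (suc n) = trans (cong f (fold-cong f≗g z n)) (f≗g _)

-- Opaque: unfolding the machine inside larger expressions makes unification explode.
opaque
  haltingTestᴱ : ∀ {n} → Expr n → Expr n → Expr n → Expr n
  haltingTestᴱ e y t = appᴱ haltFlagᴱ (foldᴱ stepᴱ (evalᴱ e y (lit 0)) t)

  ⟦haltingTestᴱ⟧ : ∀ {n} (e y t : Expr n) ρ →
    ⟦ haltingTestᴱ e y t ⟧ ρ ≡ haltingTest (⟦ e ⟧ ρ) (⟦ y ⟧ ρ) (⟦ t ⟧ ρ)
  ⟦haltingTestᴱ⟧ e y t ρ = trans (⟦haltFlagᴱ⟧ _) (cong haltFlag (trans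
    (fold-cong ⟦stepᴱ⟧ (evalState (⟦ e ⟧ ρ) (⟦ y ⟧ ρ) 0) (⟦ t ⟧ ρ))
    (iterate-is-fold _ step (⟦ t ⟧ ρ))))

smn : ℕ → ℕ → ℕ
smn q x = pair 5 (pair q (enc (P (const x) I)))

smn-encodes : ∀ q x → smn q x Encodes C (decode q) (P (const x) I)
smn-encodes q x = #C (unpair-pair 5 (pair q (enc (P (const x) I))))
  (encodes-fst _ (decode-encodes q)) (encodes-snd q (enc-encodes (P (const x) I)))

W-smn : ∀ q x y → W (smn q x) y ⇔ (∃ λ z → decode q ⊢ pair x y ⇓ z)
W-smn q x y = mk⇔ to from
  where
  decode-smn : decode (smn q x) ≡ C (decode q) (P (const x) I)
  decode-smn = decode-unique (smn-encodes q x)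
  prefixed : ∀ {z} → C (decode q) (P (const x) I) ⊢ y ⇓ z → decode q ⊢ pair x y ⇓ z
  prefixed {z} (⇓C (⇓P dx ⇓I) dq) = subst (λ a → decode q ⊢ pair a y ⇓ z) (⇓-deterministic dx (const-⇓ x)) dq
  to : W (smn q x) y → ∃ λ z → decode q ⊢ pair x y ⇓ z
  to w with z , d ← W⇒⇓ {smn q x} w = z , prefixed (subst (λ c → c ⊢ y ⇓ z) decode-smn d)
  from : (∃ λ z → decode q ⊢ pair x y ⇓ z) → W (smn q x) y
  from (z , d) = ⇓⇒W {smn q x} (subst (λ c → c ⊢ y ⇓ z) (sym decode-smn) (⇓C (⇓P (const-⇓ x) ⇓I) d))

Searches : Expr 1 → ℕ → Set
Searches e x = ∃ λ t → ⟦ e ⟧ (pair x t ∷ []) ≡ 0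

searchIndex : Expr 1 → ℕ
searchIndex e = enc (Mu (program e))

searchIndex-halts : ∀ e x → (∃ λ z → decode (searchIndex e) ⊢ x ⇓ z) ⇔ Searches e x
searchIndex-halts e x = mk⇔
  (λ (z , d) → z , Mu-program-zero e (subst (λ c → c ⊢ x ⇓ z) (decode-enc (Mu (program e))) d))
  (λ (t , h) → let z , d = Mu-program-halts e x t h in z , subst (λ c → c ⊢ x ⇓ z) (sym (decode-enc (Mu (program e)))) d)

W-searchIndex : ∀ e x → W (searchIndex e) x ⇔ Searches e x
W-searchIndex e x = ⇔-trans (W⇔⇓ (searchIndex e) x) (searchIndex-halts e x)

familyIndex : Expr 1 → ℕ → ℕ
familyIndex e x = smn (searchIndex e) x

W-familyIndex : ∀ e x y → W (familyIndex e x) y ⇔ Searches e (pair x y)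
W-familyIndex e x y = ⇔-trans (W-smn (searchIndex e) x y) (searchIndex-halts e (pair x y))

encConstᴱ : ∀ {n} → Expr n → Expr n
encConstᴱ = foldᴱ (pairᴱ (lit 5) (pairᴱ (lit 1) (# 0))) (lit 0)

familyIndexᴱ : ∀ {n} → Expr 1 → Expr n → Expr n
familyIndexᴱ e x = pairᴱ (lit 5) (pairᴱ (lit (searchIndex e)) (pairᴱ (lit 6) (pairᴱ (encConstᴱ x) (lit (enc I)))))

opaque
  unfolding ⟪_,_⟫ enc

  ⟦encConstᴱ⟧ : ∀ {n} (x : Expr n) ρ → ⟦ encConstᴱ x ⟧ ρ ≡ enc (const (⟦ x ⟧ ρ))
  ⟦encConstᴱ⟧ x ρ = go (⟦ x ⟧ ρ)
    where
    go : ∀ k → fold 0 (λ h → ⟪ 5 , ⟪ 1 , h ⟫ ⟫) k ≡ enc (const k)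
    go zero    = refl
    go (suc k) = cong (λ h → pair 5 (pair 1 h)) (go k)

  ⟦familyIndexᴱ⟧ : ∀ {n} e (x : Expr n) ρ → ⟦ familyIndexᴱ e x ⟧ ρ ≡ familyIndex e (⟦ x ⟧ ρ)
  ⟦familyIndexᴱ⟧ e x ρ = cong (λ k → pair 5 (pair (searchIndex e) (pair 6 (pair k (enc I))))) (⟦encConstᴱ⟧ x ρ)

-- Natural numbers as truth values, 0 meaning true.
either-zero : ℕ → ℕ → ℕ
either-zero a b = ifz a 0 b

both-zero : ℕ → ℕ → ℕ
both-zero a b = ifz a (ifz b 0 1) 1

either-zero-inv : ∀ a b → either-zero a b ≡ 0 → a ≡ 0 ⊎ b ≡ 0
either-zero-inv zero    b _ = inj₁ refl
either-zero-inv (suc a) b e = inj₂ e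

both-zero-inv : ∀ a b → both-zero a b ≡ 0 → a ≡ 0 × b ≡ 0
both-zero-inv zero zero _ = refl , refl

either-zeroˡ : ∀ {a} b → a ≡ 0 → either-zero a b ≡ 0
either-zeroˡ b refl = refl

either-zeroʳ : ∀ a {b} → b ≡ 0 → either-zero a b ≡ 0
either-zeroʳ zero    _    = refl
either-zeroʳ (suc a) refl = refl

eitherᴱ : ∀ {n} → Expr n → Expr n → Expr n
eitherᴱ a b = ifzᴱ a (lit 0) b

bothᴱ : ∀ {n} → Expr n → Expr n → Expr n
bothᴱ a b = ifzᴱ a (ifzᴱ b (lit 0) (lit 1)) (lit 1)

-- An expression for a family, read at ⟨ ⟨ x , y ⟩ , t ⟩ with variables 0 x, 1 y, 3 t.
familyᴱ : Expr 5 → Expr 1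
familyᴱ b = splitᴱ (# 0) (splitᴱ (# 0) b)

⟦familyᴱ⟧ : ∀ b x y t →
  ⟦ familyᴱ b ⟧ (pair (pair x y) t ∷ []) ≡ ⟦ b ⟧ (x ∷ y ∷ pair x y ∷ t ∷ pair (pair x y) t ∷ [])
⟦familyᴱ⟧ b x y t = trans (split-pair (# 0) (splitᴱ (# 0) b) (pair (pair x y) t ∷ []) refl)
                          (split-pair (# 0) b (pair x y ∷ t ∷ pair (pair x y) t ∷ []) refl)

monusᴱ : ∀ {n} → Expr n → Expr n → Expr n
monusᴱ = foldᴱ (predᴱ (# 0))

fold-pred : ∀ a k → fold a pred k ≡ a ∸ k
fold-pred a zero    = refl
fold-pred a (suc k) = trans (cong pred (fold-pred a k)) (pred[m∸n]≡m∸[1+n] a k)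

equalityBody : Expr 5
equalityBody = bothᴱ (monusᴱ (# 1) (# 0)) (monusᴱ (# 0) (# 1))

equalityᴱ : Expr 1
equalityᴱ = familyᴱ equalityBody

⟦equalityᴱ⟧ : ∀ x y t → ⟦ equalityᴱ ⟧ (pair (pair x y) t ∷ []) ≡ both-zero (y ∸ x) (x ∸ y)
⟦equalityᴱ⟧ x y t = trans (⟦familyᴱ⟧ equalityBody x y t) (cong₂ both-zero (fold-pred y x) (fold-pred x y))

singletonIndex : ℕ → ℕ
singletonIndex = familyIndex equalityᴱ

W-singletonIndex : ∀ n y → W (singletonIndex n) y ⇔ y ≡ n
W-singletonIndex n y = ⇔-trans (W-familyIndex equalityᴱ n y) (mk⇔ to from)
  where
  to : Searches equalityᴱ (pair n y) → y ≡ n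
  to (t , h) with y∸n≡0 , n∸y≡0 ← both-zero-inv (y ∸ n) (n ∸ y) (trans (sym (⟦equalityᴱ⟧ n y t)) h) =
    ≤-antisym (m∸n≡0⇒m≤n y∸n≡0) (m∸n≡0⇒m≤n n∸y≡0)
  from : y ≡ n → Searches equalityᴱ (pair n y)
  from refl = 0 , trans (⟦equalityᴱ⟧ n n 0) (cong (λ a → both-zero a a) (n∸n≡0 n))

singletonCE : ℕ → CE
singletonCE n = W̃ (singletonIndex n)

singletonCE≐ : ∀ n → set (singletonCE n) ≐ singleton n
singletonCE≐ n = Equivalence.to (W-singletonIndex n _) , Equivalence.from (W-singletonIndex n _)

computable₂ᴱ : ∀ {f : ℕ → ℕ → ℕ} → Computable₂ f → ∀ {n} → Expr n → Expr n → Expr n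
computable₂ᴱ {f} cf a b = extᴱ f₂ (proj₁ (program-of {f₂} cf)) (proj₂ (program-of {f₂} cf)) (pairᴱ a b)
  where
  f₂ : ℕ → ℕ
  f₂ p = f (fst p) (snd p)

⟦computable₂ᴱ⟧ : ∀ {f : ℕ → ℕ → ℕ} (cf : Computable₂ f) {n} (a b : Expr n) ρ →
  ⟦ computable₂ᴱ {f} cf a b ⟧ ρ ≡ f (⟦ a ⟧ ρ) (⟦ b ⟧ ρ)
⟦computable₂ᴱ⟧ {f} cf a b ρ = cong₂ f (fst-⟪⟫ (⟦ a ⟧ ρ) (⟦ b ⟧ ρ)) (snd-⟪⟫ (⟦ a ⟧ ρ) (⟦ b ⟧ ρ))

-- Dovetailing: search for a pair ⟨ m , t ⟩ such that m is seen in W (h n) within t steps.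
unique-element-computable : ∀ (h : Expr 1) {F : ℕ → ℕ} → (∀ n → W (⟦ h ⟧ (n ∷ [])) ≐ singleton (F n)) → Computable F
unique-element-computable h {F} W≐F = computable-by (C L (Mu (program searchᴱ))) found
  where
  searchᴱ : Expr 1
  searchᴱ = splitᴱ (# 0) (haltingTestᴱ (appᴱ h (# 0)) (fstᴱ (# 1)) (sndᴱ (# 1)))
  ⟦searchᴱ⟧ : ∀ n p → ⟦ searchᴱ ⟧ (pair n p ∷ []) ≡ haltingTest (⟦ h ⟧ (n ∷ [])) (fst p) (snd p)
  ⟦searchᴱ⟧ n p = trans (split-pair (# 0) (haltingTestᴱ (appᴱ h (# 0)) (fstᴱ (# 1)) (sndᴱ (# 1))) (pair n p ∷ []) refl)
                        (⟦haltingTestᴱ⟧ (appᴱ h (# 0)) (fstᴱ (# 1)) (sndᴱ (# 1)) (n ∷ p ∷ pair n p ∷ []))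
  searched : ∀ n t → haltingTest (⟦ h ⟧ (n ∷ [])) (F n) t ≡ 0 → ⟦ searchᴱ ⟧ (pair n (pair (F n) t) ∷ []) ≡ 0
  searched n t ht = trans (⟦searchᴱ⟧ n _) (trans (cong₂ (haltingTest _) (fst-pair (F n) t) (snd-pair (F n) t)) ht)
  found : ∀ n → C L (Mu (program searchᴱ)) ⊢ n ⇓ F n
  found n with t , ht ← W⇒haltingTest _ (F n) (proj₂ (W≐F n) refl)
          with p , d ← Mu-program-halts searchᴱ n (pair (F n) t) (searched n t ht) =
    ⇓-subst (⇓C d ⇓L) (proj₁ (W≐F n)
      (haltingTest⇒W _ (fst p) (snd p) (trans (sym (⟦searchᴱ⟧ n p)) (Mu-program-zero searchᴱ d))))

haltsAtᴱ : Expr 1 → ℕ → Expr 1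
haltsAtᴱ h m = splitᴱ (# 0) (haltingTestᴱ (appᴱ h (# 0)) (lit m) (# 1))

preimageIndex : Expr 1 → ℕ → ℕ
preimageIndex h m = searchIndex (haltsAtᴱ h m)

W-preimageIndex : ∀ h m x → W (preimageIndex h m) x ⇔ W (⟦ h ⟧ (x ∷ [])) m
W-preimageIndex h m x = ⇔-trans (W-searchIndex (haltsAtᴱ h m) x) (mk⇔
  (λ (t , e) → haltingTest⇒W (⟦ h ⟧ (x ∷ [])) m t (trans (sym (⟦haltsAtᴱ⟧ t)) e))
  (λ w → let t , e = W⇒haltingTest (⟦ h ⟧ (x ∷ [])) m w in t , trans (⟦haltsAtᴱ⟧ t) e))
  where
  ⟦haltsAtᴱ⟧ : ∀ t → ⟦ haltsAtᴱ h m ⟧ (pair x t ∷ []) ≡ haltingTest (⟦ h ⟧ (x ∷ [])) m t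
  ⟦haltsAtᴱ⟧ t = trans (split-pair (# 0) (haltingTestᴱ (appᴱ h (# 0)) (lit m) (# 1)) (pair x t ∷ []) refl)
                       (⟦haltingTestᴱ⟧ (appᴱ h (# 0)) (lit m) (# 1) (x ∷ t ∷ pair x t ∷ []))

conditionalUnionBody : ℕ → ℕ → Expr 5
conditionalUnionBody a b = eitherᴱ (haltingTestᴱ (lit a) (# 1) (# 3))
  (bothᴱ (haltingTestᴱ (# 0) (# 0) (fstᴱ (# 3))) (haltingTestᴱ (lit b) (# 1) (sndᴱ (# 3))))

conditionalUnionᴱ : ℕ → ℕ → Expr 1
conditionalUnionᴱ a b = familyᴱ (conditionalUnionBody a b)

W-conditionalUnion : ∀ a b x y → W (familyIndex (conditionalUnionᴱ a b) x) y ⇔ (W a y ⊎ (W x x × W b y))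
W-conditionalUnion a b x y = ⇔-trans (W-familyIndex (conditionalUnionᴱ a b) x y) (mk⇔ to from)
  where
  test : ∀ t → ⟦ conditionalUnionᴱ a b ⟧ (pair (pair x y) t ∷ []) ≡
    either-zero (haltingTest a y t) (both-zero (haltingTest x x (fst t)) (haltingTest b y (snd t)))
  test t = trans (⟦familyᴱ⟧ (conditionalUnionBody a b) x y t) (cong₂ either-zero (⟦haltingTestᴱ⟧ (lit a) (# 1) (# 3) ρ)
    (cong₂ both-zero (⟦haltingTestᴱ⟧ (# 0) (# 0) (fstᴱ (# 3)) ρ) (⟦haltingTestᴱ⟧ (lit b) (# 1) (sndᴱ (# 3)) ρ)))
    where
    ρ : Vec ℕ 5
    ρ = x ∷ y ∷ pair x y ∷ t ∷ pair (pair x y) t ∷ []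
  to : Searches (conditionalUnionᴱ a b) (pair x y) → W a y ⊎ (W x x × W b y)
  to (t , e) with either-zero-inv (haltingTest a y t) _ (trans (sym (test t)) e)
  ... | inj₁ ha = inj₁ (haltingTest⇒W a y t ha)
  ... | inj₂ hxb with hx , hb ← both-zero-inv (haltingTest x x (fst t)) (haltingTest b y (snd t)) hxb =
    inj₂ (haltingTest⇒W x x (fst t) hx , haltingTest⇒W b y (snd t) hb)
  from : W a y ⊎ (W x x × W b y) → Searches (conditionalUnionᴱ a b) (pair x y)
  from (inj₁ wa) with t , ha ← W⇒haltingTest a y wa = t , trans (test t) (either-zeroˡ _ ha)
  from (inj₂ (wx , wb)) with t₁ , hx ← W⇒haltingTest x x wx | t₂ , hb ← W⇒haltingTest b y wb =
    pair t₁ t₂ , trans (test (pair t₁ t₂)) (either-zeroʳ (haltingTest a y (pair t₁ t₂)) (cong₂ both-zero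
      (trans (cong (haltingTest x x) (fst-pair t₁ t₂)) hx) (trans (cong (haltingTest b y) (snd-pair t₁ t₂)) hb)))

complement-of-K-not-ce : ∀ d → ¬ (∀ x → (W x x → ¬ W d x) × (¬ W x x → W d x))
complement-of-K-not-ce d K̅≐Wd = not-in (proj₂ (K̅≐Wd d) not-in)
  where
  not-in : ¬ W d d
  not-in w = proj₁ (K̅≐Wd d) w w

module _ (G : ComputableGroup) (A : Action G) where
  open ComputableGroup G
  open Action A

  act-cancel : ∀ {δ δ′} → InG δ → InG δ′ → δ′ ∙ δ ≡ ε → ∀ V → set (act δ′ (act δ V)) ≐ set V
  act-cancel δ∈G δ′∈G δ′δ≡ε V =
    (λ p → proj₁ (act-ε V) (subst (λ g → set (act g V) _) δ′δ≡ε (proj₂ (act-∙ δ′∈G δ∈G V) p))) ,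
    (λ p → proj₁ (act-∙ δ′∈G δ∈G V) (subst (λ g → set (act g V) _) (sym δ′δ≡ε) (proj₂ (act-ε V) p)))

  act-¬¬-mono : ComputableInIndices G A → ∀ {δ} → InG δ → ∀ U V → set U ⊆ set V →
    ∀ {m} → set (act δ U) m → ¬ ¬ set (act δ V) m
  act-¬¬-mono (α , α-computable , W-α) {δ} δ∈G U@(_ , a , U≐Wa) V@(_ , b , V≐Wb) U⊆V {m} m∈δU m∉δV =
    complement-of-K-not-ce d (λ x → in-K x , not-in-K x)
    where
    f : ℕ → ℕ
    f = familyIndex (conditionalUnionᴱ a b)
    hᴱ : Expr 1
    hᴱ = computable₂ᴱ {α} α-computable (lit δ) (familyIndexᴱ (conditionalUnionᴱ a b) (# 0))
    ⟦hᴱ⟧ : ∀ x → ⟦ hᴱ ⟧ (x ∷ []) ≡ α δ (f x)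
    ⟦hᴱ⟧ x = trans (⟦computable₂ᴱ⟧ {α} α-computable (lit δ) (familyIndexᴱ (conditionalUnionᴱ a b) (# 0)) (x ∷ []))
      (cong (α δ) (⟦familyIndexᴱ⟧ (conditionalUnionᴱ a b) (# 0) (x ∷ [])))
    d : ℕ
    d = preimageIndex hᴱ m
    W-d : ∀ x → W d x ⇔ set (act δ (W̃ (f x))) m
    W-d x = ⇔-trans (W-preimageIndex hᴱ m x)
      (subst (λ e → W e m ⇔ set (act δ (W̃ (f x))) m) (sym (⟦hᴱ⟧ x))
        (mk⇔ (proj₁ (W-α δ δ∈G (f x))) (proj₂ (W-α δ δ∈G (f x)))))
    Wf≐V : ∀ {x} → W x x → W (f x) ≐ set V
    Wf≐V x∈K = (λ w → [ (λ wa → U⊆V (proj₂ U≐Wa wa)) , (λ (_ , wb) → proj₂ V≐Wb wb) ]′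
                          (Equivalence.to (W-conditionalUnion a b _ _) w))
             , (λ v → Equivalence.from (W-conditionalUnion a b _ _) (inj₂ (x∈K , proj₁ V≐Wb v)))
    U≐Wf : ∀ {x} → ¬ W x x → set U ≐ W (f x)
    U≐Wf x∉K = (λ u → Equivalence.from (W-conditionalUnion a b _ _) (inj₁ (proj₁ U≐Wa u)))
             , (λ w → [ proj₂ U≐Wa , (λ (x∈K , _) → ⊥-elim (x∉K x∈K)) ]′
                          (Equivalence.to (W-conditionalUnion a b _ _) w))
    in-K : ∀ x → W x x → ¬ W d x
    in-K x x∈K x∈d = m∉δV (proj₁ (act-cong δ∈G (W̃ (f x)) V (Wf≐V x∈K)) (Equivalence.to (W-d x) x∈d))
    not-in-K : ∀ x → ¬ W x x → W d x
    not-in-K x x∉K = Equivalence.from (W-d x) (proj₁ (act-cong δ∈G U (W̃ (f x)) (U≐Wf x∉K)) m∈δU)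

  module _ (lem : ExcludedMiddle 0ℓ) (ci : ComputableInIndices G A) where

    act-mono : ∀ {δ} → InG δ → ∀ U V → set U ⊆ set V → set (act δ U) ⊆ set (act δ V)
    act-mono δ∈G U V U⊆V m∈δU = em⇒dne lem (act-¬¬-mono ci δ∈G U V U⊆V m∈δU)

    act-point : ∀ {δ} → InG δ → ∀ V {n} → set V n → set (act δ (singletonCE n)) ⊆ set (act δ V)
    act-point δ∈G V n∈V = act-mono δ∈G (singletonCE _) V (λ w → subst (set V) (sym (proj₁ (singletonCE≐ _) w)) n∈V)

    -- If δ · {n} were empty it would lie inside δ · {n + 1}, and cancelling δ would give {n} ⊆ {n + 1}.
    act-singleton-nonempty : ∀ {δ δ′} → InG δ → InG δ′ → δ′ ∙ δ ≡ ε →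
      ∀ n → ∃ λ m → set (act δ (singletonCE n)) m
    act-singleton-nonempty {δ} {δ′} δ∈G δ′∈G δ′δ≡ε n = em⇒dne lem λ empty →
      1+n≢n (sym (proj₁ (singletonCE≐ (suc n)) (proj₁ (act-cancel δ∈G δ′∈G δ′δ≡ε (singletonCE (suc n)))
        (act-mono δ′∈G (act δ (singletonCE n)) (act δ (singletonCE (suc n))) (λ {m} m∈ → ⊥-elim (empty (m , m∈)))
          (proj₂ (act-cancel δ∈G δ′∈G δ′δ≡ε (singletonCE n)) (proj₂ (singletonCE≐ n) refl))))))

    act-singleton : ∀ {δ δ′} → InG δ → InG δ′ → δ′ ∙ δ ≡ ε → δ ∙ δ′ ≡ ε →
      ∀ n → ∃ λ m → set (act δ (singletonCE n)) ≐ singleton m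
    act-singleton {δ} {δ′} δ∈G δ′∈G δ′δ≡ε δδ′≡ε n = m , δn⊆m , λ { refl → m∈δn }
      where
      m : ℕ
      m = proj₁ (act-singleton-nonempty δ∈G δ′∈G δ′δ≡ε n)
      m∈δn : set (act δ (singletonCE n)) m
      m∈δn = proj₂ (act-singleton-nonempty δ∈G δ′∈G δ′δ≡ε n)
      n′ : ℕ
      n′ = proj₁ (act-singleton-nonempty δ′∈G δ∈G δδ′≡ε m)
      n′∈δ′m : set (act δ′ (singletonCE m)) n′
      n′∈δ′m = proj₂ (act-singleton-nonempty δ′∈G δ∈G δδ′≡ε m)
      n′≡n : n′ ≡ n
      n′≡n = proj₁ (singletonCE≐ n) (proj₁ (act-cancel δ∈G δ′∈G δ′δ≡ε (singletonCE n))
        (act-point δ′∈G (act δ (singletonCE n)) m∈δn n′∈δ′m))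
      δn⊆m : set (act δ (singletonCE n)) ⊆ singleton m
      δn⊆m p = proj₁ (singletonCE≐ m) (proj₁ (act-cancel δ′∈G δ∈G δδ′≡ε (singletonCE m))
        (act-point δ∈G (act δ′ (singletonCE m)) (subst (set (act δ′ (singletonCE m))) n′≡n n′∈δ′m) p))

    act-singleton-cancel : ∀ {δ δ′ n k j} → InG δ → InG δ′ → δ′ ∙ δ ≡ ε →
      set (act δ (singletonCE n)) ≐ singleton k → set (act δ′ (singletonCE k)) ≐ singleton j → j ≡ n
    act-singleton-cancel {δ} {δ′} {n} {k} δ∈G δ′∈G δ′δ≡ε δn≐k δ′k≐j =
      proj₁ (singletonCE≐ n) (proj₁ (act-cancel δ∈G δ′∈G δ′δ≡ε (singletonCE n))
        (proj₁ (act-cong δ′∈G (singletonCE k) (act δ (singletonCE n)) (≐-trans (singletonCE≐ k) (≐-sym δn≐k)))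
          (proj₂ δ′k≐j refl)))

    module Permutation {γ} (γ∈G : InG γ) where
      γ⁻¹∈G : InG (γ ⁻¹)
      γ⁻¹∈G = ⁻¹-closed γ∈G

      F : ℕ → ℕ
      F n = proj₁ (act-singleton γ∈G γ⁻¹∈G (inverseˡ γ∈G) (inverseʳ γ∈G) n)

      F⁻¹ : ℕ → ℕ
      F⁻¹ m = proj₁ (act-singleton γ⁻¹∈G γ∈G (inverseʳ γ∈G) (inverseˡ γ∈G) m)

      act-singletonCE : ∀ n → set (act γ (singletonCE n)) ≐ singleton (F n)
      act-singletonCE n = proj₂ (act-singleton γ∈G γ⁻¹∈G (inverseˡ γ∈G) (inverseʳ γ∈G) n)

      act⁻¹-singletonCE : ∀ m → set (act (γ ⁻¹) (singletonCE m)) ≐ singleton (F⁻¹ m)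
      act⁻¹-singletonCE m = proj₂ (act-singleton γ⁻¹∈G γ∈G (inverseʳ γ∈G) (inverseˡ γ∈G) m)

      F⁻¹∘F : ∀ n → F⁻¹ (F n) ≡ n
      F⁻¹∘F n = act-singleton-cancel γ∈G γ⁻¹∈G (inverseˡ γ∈G) (act-singletonCE n) (act⁻¹-singletonCE (F n))

      F∘F⁻¹ : ∀ m → F (F⁻¹ m) ≡ m
      F∘F⁻¹ m = act-singleton-cancel γ⁻¹∈G γ∈G (inverseʳ γ∈G) (act⁻¹-singletonCE m) (act-singletonCE (F⁻¹ m))

      act-on-singleton : ∀ n m (U : CE) → set U ≐ singleton n → (set (act γ U) ≐ singleton m ⇔ F n ≡ m)
      act-on-singleton n m U U≐n = mk⇔ (λ γU≐m → proj₁ γU≐m (proj₂ γU≐Fn refl)) (λ { refl → γU≐Fn })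
        where
        γU≐Fn : set (act γ U) ≐ singleton (F n)
        γU≐Fn = ≐-trans (act-cong γ∈G U (singletonCE n) (≐-trans U≐n (≐-sym (singletonCE≐ n)))) (act-singletonCE n)

      F-bijective : Bijective _≡_ _≡_ F
      F-bijective = (λ {x} {y} Fx≡Fy → trans (sym (F⁻¹∘F x)) (trans (cong F⁻¹ Fx≡Fy) (F⁻¹∘F y)))
                  , (λ m → F⁻¹ m , λ { refl → F∘F⁻¹ m })

      act≐image : ∀ (V : CE) → set (act γ V) ≐ image F (set V)
      act≐image V = (λ {m} m∈γV → F⁻¹ m , F⁻¹m∈V m∈γV , F∘F⁻¹ m)
                  , (λ { (n , n∈V , refl) → act-point γ∈G V n∈V (proj₂ (act-singletonCE n) refl) })
        where
        F⁻¹m∈V : ∀ {m} → set (act γ V) m → set V (F⁻¹ m)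
        F⁻¹m∈V m∈γV = proj₁ (act-cancel γ∈G γ⁻¹∈G (inverseˡ γ∈G) V)
          (act-point γ⁻¹∈G (act γ V) m∈γV (proj₂ (act⁻¹-singletonCE _) refl))

      F-computable : Computable F
      F-computable = unique-element-computable hᴱ W≐F
        where
        α : ℕ → ℕ → ℕ
        α = proj₁ ci
        α-computable : Computable₂ α
        α-computable = proj₁ (proj₂ ci)
        hᴱ : Expr 1
        hᴱ = computable₂ᴱ {α} α-computable (lit γ) (familyIndexᴱ equalityᴱ (# 0))
        W≐F : ∀ n → W (⟦ hᴱ ⟧ (n ∷ [])) ≐ singleton (F n)
        W≐F n = subst (λ e → W e ≐ singleton (F n))
          (sym (trans (⟦computable₂ᴱ⟧ {α} α-computable (lit γ) (familyIndexᴱ equalityᴱ (# 0)) (n ∷ []))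
                      (cong (α γ) (⟦familyIndexᴱ⟧ equalityᴱ (# 0) (n ∷ [])))))
          (≐-trans (proj₂ (proj₂ ci) γ γ∈G (singletonIndex n)) (act-singletonCE n))

lemma2p4 : ExcludedMiddle 0ℓ →
    (G : ComputableGroup) (A : Action G) → ComputableInIndices G A →
    ∀ γ → ComputableGroup.InG G γ →
    Σ (ℕ → ℕ) λ F →
      (∀ n m (U : CE) → set U ≐ singleton n →
         (set (Action.act A γ U) ≐ singleton m ⇔ F n ≡ m))
      × Computable F
      × Bijective _≡_ _≡_ F
      × (∀ (V : CE) → set (Action.act A γ V) ≐ image F (set V))
lemma2p4 lem G A ci γ γ∈G = F , act-on-singleton , F-computable , F-bijective , act≐image
  where open Permutation G A lem ci γ∈G
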